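{- Let $\Gamma$ be a connected finite graph, and let $H^i_{\Phi+d}(\Gamma)$ denote the cohomology of the complex $(C^*(\Gamma),\Phi+d)$. 1. If $\Gamma$ is not bipartite, then $H^i_{\Phi+d}(\Gamma)=0$ for all $i$. 2. If $\Gamma$ is bipartite, then $H^i_{\Phi+d}(\Gamma)=0$ for all $i>0$, and $H^0_{\Phi+d}(\Gamma)\cong\mathbb{Q}^2$ with basis $\{S_0,S_1\}$. Here, for a bipartition $V(\Gamma)=V_0\sqcup V_1$: - $S_0\in C^0(\Gamma)=\bigotimes_{v}\mathcal{C}$ carries $a_0=\tfrac12(x+1)$ at each vertex of $V_0$ and $a_1=\tfrac12(x-1)$ at each vertex of $V_1$; - $S_1$ carries $a_1$ on $V_0$ and $a_0$ on $V_1$.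
   Context: Let $\Gamma$ be a finite graph (loops and multiple edges allowed; a graph with a loop is not bipartite) with totally ordered edges. States. A state is a spanning subgraph $s$ of $\Gamma$. Its dimension is its number of edges. An enhanced state labels each connected component of $s$ by $1$ or $x$. Cochain groups. $C^i(\Gamma)$ is the $\mathbb{Q}$-vector space with basis the enhanced states of dimension $i$. The span of the enhanced states on a state $s$ is identified with $\mathcal{C}^{\otimes(\text{components of }s)}$, where $\mathcal{C}$ has basis $1,x$. In particular $C^0(\Gamma)=\bigotimes_{v\in V(\Gamma)}\mathcal{C}$. The operator $\Phi+d$. Let $n(s,e)$ be the number of edges of $s$ smaller than $e$, and set $(\Phi+d)(S)=\sum_{e\notin s}(-1)^{n(s,e)}T_e$. Here: - if both endpoints of $e$ lie in one component of $s$, then $T_e$ is the enhanced state on $s\cup\{e\}$ with the same labels; - if $e$ joins distinct components labelled $a,b$, then the merged component is labelled by $ab$ in $\mathcal{C}=\mathbb{Q}[x]/(x^2-1)$ ($1\cdot1=1$, $1\cdot x=x\cdot1=x$, $x\cdot x=1$). Here $d$ is the chromatic differential, which uses $\mathbb{Q}[x]/(x^2)$ instead, and $\Phi$ is the part of $\Phi+d$ coming from merging two $x$-labelled components into a $1$-labelled one. The operator $\Phi+d$ squares to zero. -}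

module Defs where

open import Data.Nat as ℕ using (ℕ; zero; suc; _<_)
open import Data.Fin as Fin using (Fin; zero; suc)
open import Data.Fin.Subset using (Subset; ∣_∣; ⊤)
open import Data.Bool using (Bool; true; false; _∧_; _∨_; not; if_then_else_)
open import Data.Vec as Vec using (Vec; []; _∷_; lookup; tabulate; _[_]≔_)
open import Data.List as List using (List; []; _∷_; _++_)
open import Data.Product using (Σ; _×_; _,_; proj₁; proj₂; ∃)
open import Data.Rational as ℚ using (ℚ; 0ℚ; 1ℚ; ½; -½; _+_; _*_; -_)
open import Relation.Binary.PropositionalEquality using (_≡_; _≢_)
open import Relation.Nullary using (¬_; does)

-- Finite graphs (loops, multiple edges allowed); edges are Fin nE,
-- totally ordered by the order of Fin.

record Graph : Set where
  field
    nV   : ℕ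
    nE   : ℕ
    ends : Fin nE → Fin nV × Fin nV

module _ (Γ : Graph) where
  open Graph Γ

  src tgt : Fin nE → Fin nV
  src e = proj₁ (ends e)
  tgt e = proj₂ (ends e)

  -- A state = spanning subgraph = subset of the edges.
  State : Set
  State = Subset nE

  anyFin : {k : ℕ} → (Fin k → Bool) → Bool
  anyFin {zero}  f = false
  anyFin {suc k} f = f zero ∨ anyFin (λ i → f (suc i))

  _=ᵛ_ : Fin nV → Fin nV → Bool
  u =ᵛ v = does (u Fin.≟ v)

  step : State → Subset nV → Subset nV
  step s R = tabulate λ w → lookup R w ∨
    anyFin (λ e → lookup s e ∧
      ((lookup R (src e) ∧ (tgt e =ᵛ w)) ∨ (lookup R (tgt e) ∧ (src e =ᵛ w))))

  iter : ℕ → State → Subset nV → Subset nV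
  iter zero    s R = R
  iter (suc k) s R = step s (iter k s R)

  singleton : Fin nV → Subset nV
  singleton u = tabulate λ w → u =ᵛ w

  -- Vertex set of the connected component of u in s
  -- (nV steps of breadth-first search suffice).
  component : State → Fin nV → Subset nV
  component s u = iter nV s (singleton u)

  sameComp : State → Fin nV → Fin nV → Bool
  sameComp s u v = lookup (component s u) v

  Connected : Set
  Connected = (0 < nV) × (∀ u v → sameComp ⊤ u v ≡ true)

  -- Bipartitions: V₀ = {v | col v ≡ false}, V₁ = {v | col v ≡ true}.
  IsBipartition : (Fin nV → Bool) → Set
  IsBipartition col = ∀ e → col (src e) ≢ col (tgt e)

  Bipartite : Set
  Bipartite = Σ (Fin nV → Bool) IsBipartition

-- Labels: basis {1, x} of 𝒞 = ℚ[x]/(x² - 1); product of basis elements.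

data Label : Set where
  one ex : Label

mulL : Label → Label → Label
mulL one b  = b
mulL ex one = ex
mulL ex ex  = one

eqL : Label → Label → Bool
eqL one one = true
eqL ex  ex  = true
eqL _   _   = false

eqVecL : {k : ℕ} → Vec Label k → Vec Label k → Bool
eqVecL []       []       = true
eqVecL (a ∷ as) (b ∷ bs) = eqL a b ∧ eqVecL as bs

allLabellings : (k : ℕ) → List (Vec Label k)
allLabellings zero    = [] ∷ []
allLabellings (suc k) =
  List.map (one ∷_) (allLabellings k) ++ List.map (ex ∷_) (allLabellings k)

sumList : {A : Set} → List A → (A → ℚ) → ℚ
sumList []       f = 0ℚ
sumList (a ∷ as) f = f a + sumList as f

sumFin : (k : ℕ) → (Fin k → ℚ) → ℚ
sumFin zero    f = 0ℚ
sumFin (suc k) f = f zero + sumFin k (λ i → f (suc i))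

prodFin : (k : ℕ) → (Fin k → ℚ) → ℚ
prodFin zero    f = 1ℚ
prodFin (suc k) f = f zero * prodFin k (λ i → f (suc i))

countFin : (k : ℕ) → (Fin k → Bool) → ℕ
countFin zero    f = zero
countFin (suc k) f = (if f zero then 1 else 0) ℕ.+ countFin k (λ i → f (suc i))

signℚ : ℕ → ℚ
signℚ zero    = 1ℚ
signℚ (suc k) = - signℚ k

-- An enhanced state on s is represented by a vertex labelling
-- ℓ : Vec Label nV which is constant on the connected components of s
-- (this is the label of each component).  A cochain is the coefficient
-- function on enhanced states; it must vanish on non-enhanced-states.

module _ (Γ : Graph) where
  open Graph Γ

  Labelling : Set
  Labelling = Vec Label nV

  Valid : State Γ → Labelling → Set
  Valid s ℓ = ∀ u v → sameComp Γ s u v ≡ true → lookup ℓ u ≡ lookup ℓ v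

  Cochain : Set
  Cochain = State Γ → Labelling → ℚ

  IsCochain : ℕ → Cochain → Set
  IsCochain i c = (∀ s ℓ → ∣ s ∣ ≢ i → c s ℓ ≡ 0ℚ)
                × (∀ s ℓ → ¬ Valid s ℓ → c s ℓ ≡ 0ℚ)

  _≗ᶜ_ : Cochain → Cochain → Set
  c ≗ᶜ c′ = ∀ s ℓ → c s ℓ ≡ c′ s ℓ

  zeroᶜ : Cochain
  zeroᶜ s ℓ = 0ℚ

  nse : State Γ → Fin nE → ℕ
  nse s e = countFin nE (λ e′ → lookup s e′ ∧ does (e′ Fin.<? e))

  Tlab : State Γ → Fin nE → Labelling → Labelling
  Tlab s e ℓ =
    if sameComp Γ s (src Γ e) (tgt Γ e) then ℓ
    else tabulate λ v →
      if sameComp Γ s (src Γ e) v ∨ sameComp Γ s (tgt Γ e) v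
      then mulL (lookup ℓ (src Γ e)) (lookup ℓ (tgt Γ e))
      else lookup ℓ v

  -- The operator Φ + d on coefficient functions:
  -- (Φ+d)(s,ℓ) = Σ_{e ∉ s} (-1)^{n(s,e)} (s ∪ {e}, Tlab s e ℓ),
  -- so the coefficient of (t, μ) in (Φ+d)c collects, for each e ∈ t,
  -- the enhanced states (t ∖ {e}, ℓ) with Tlab (t∖{e}) e ℓ = μ.
  D : Cochain → Cochain
  D c t μ = sumFin nE λ e →
    if lookup t e
    then (let s = t [ e ]≔ false in
          sumList (allLabellings nV) λ ℓ →
            if eqVecL (Tlab s e ℓ) μ then signℚ (nse s e) * c s ℓ else 0ℚ)
    else 0ℚ

  -- c ∈ C^i is a coboundary (C^{-1} = 0, so in degree 0 only 0 is).
  IsCoboundary : ℕ → Cochain → Set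
  IsCoboundary zero    c = c ≗ᶜ zeroᶜ
  IsCoboundary (suc j) c = ∃ λ b → IsCochain j b × (D b ≗ᶜ c)

  HVanishes : ℕ → Set
  HVanishes i = ∀ c → IsCochain i c → D c ≗ᶜ zeroᶜ → IsCoboundary i c

  -- Coefficients of a₀ = ½(x+1) and a₁ = ½(x-1) in the basis {1, x}.
  a₀ : Label → ℚ
  a₀ one = ½
  a₀ ex  = ½

  a₁ : Label → ℚ
  a₁ one = -½
  a₁ ex  = ½

  isEmpty : State Γ → Bool
  isEmpty s = not (anyFin Γ (lookup s))

  -- S₀ : a₀ on V₀ (col = false), a₁ on V₁ (col = true);
  -- as element of C⁰ = ⊗_v 𝒞, coefficient of the basis tensor ℓ.
  S₀ S₁ : (Fin nV → Bool) → Cochain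
  S₀ col s ℓ = if isEmpty s
    then prodFin nV (λ v → if col v then a₁ (lookup ℓ v) else a₀ (lookup ℓ v))
    else 0ℚ
  S₁ col s ℓ = if isEmpty s
    then prodFin nV (λ v → if col v then a₀ (lookup ℓ v) else a₁ (lookup ℓ v))
    else 0ℚ

  lin : ℚ → Cochain → ℚ → Cochain → Cochain
  lin a c b c′ s ℓ = a * c s ℓ + b * c′ s ℓ

  -- {A, B} is a basis of H⁰_{Φ+d}(Γ) = ker((Φ+d) : C⁰ → C¹)
  IsH0Basis : Cochain → Cochain → Set
  IsH0Basis A B =
      IsCochain 0 A × IsCochain 0 B
    × (D A ≗ᶜ zeroᶜ) × (D B ≗ᶜ zeroᶜ)
    × (∀ a b → lin a A b B ≗ᶜ zeroᶜ → (a ≡ 0ℚ × b ≡ 0ℚ))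
    × (∀ c → IsCochain 0 c → D c ≗ᶜ zeroᶜ → ∃ λ a → ∃ λ b → c ≗ᶜ lin a A b B)

{-# OPTIONS --safe #-}
module Submission where

-- Over ℚ the algebra 𝒞 = ℚ[x]/(x² − 1) splits as ℚ × ℚ via its two characters x ↦ 1 and
-- x ↦ −1 (equivalently, its idempotents a₀ and −a₁).  Changing basis on every component (ℱ, with
-- inverse ℱ⁻¹) replaces an enhanced state by a pair (s, κ), where κ labels the vertices by
-- characters and is constant on the components of s.  Since characters are multiplicative,
-- Φ + d becomes D̂, which never changes κ and adds only edges on which κ is constant.  For fixed
-- κ this is the coboundary of the full simplex on the κ-monochromatic edges, contracted by the
-- cone over any such edge.  What survives is the empty state under a colouring with no
-- monochromatic edge, i.e. a proper 2-colouring: there is none unless the connected graph is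
-- bipartite, and then there are exactly two, dual to S₀ and S₁.

open import Defs
open import Data.Nat using (ℕ; _<_)
open import Data.Fin using (Fin)
open import Data.Bool using (Bool)
open import Data.Product using (_×_)
open import Relation.Nullary using (¬_)

open import Data.Bool using (true; false; _∧_; _∨_; not; if_then_else_)
import Data.Bool.Properties as Boolₚ
open import Data.Empty using (⊥-elim)
open import Data.Fin using (zero; suc; toℕ; _≟_; _<?_; punchOut)
open import Data.Fin.Subset using (Subset; ∣_∣; ⊤)
import Data.Fin.Subset as Subset
import Data.Fin.Subset.Properties as Subsetₚ
import Data.Fin.Properties as Finₚ
open import Data.List using (List; []; _∷_; _++_)
import Data.List as List
open import Data.Nat as ℕ using (zero; suc; _≤_; z≤n; s≤s)
import Data.Nat.Properties as ℕₚ
open import Algebra.Properties.CommutativeSemigroup ℕₚ.+-commutativeSemigroup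
  using () renaming (x∙yz≈y∙xz to +-x∙yz≈y∙xz)
open import Data.Product using (∃; _,_; proj₁; proj₂)
open import Data.Rational using (ℚ; 0ℚ; 1ℚ; ½; _+_; _*_; _-_; -_)
open import Data.Rational.Properties
  using (+-identityˡ; +-identityʳ; *-identityˡ; *-identityʳ; *-zeroˡ; *-zeroʳ; *-assoc; *-comm; *-distribʳ-+)
open import Data.Rational.Solver using (module +-*-Solver)
open import Data.Sum using (_⊎_; inj₁; inj₂)
open import Data.Vec using (Vec; []; _∷_; lookup; tabulate; _[_]≔_)
import Data.Vec.Properties as Vecₚ
open import Data.Vec.Functional using (updateAt)
open import Data.Vec.Functional.Properties using (updateAt-updates; updateAt-minimal)
open import Function using (const; _∘_)
open import Relation.Binary.Definitions using (tri<; tri≈; tri>)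
open import Relation.Binary.PropositionalEquality
open import Relation.Nullary using (Dec; yes; no; does)
open import Relation.Nullary.Decidable using (dec-true; dec-false)

open +-*-Solver using (solve; _:+_; _:*_; _:-_; :-_; _:=_; con)

∧-true⁻ : ∀ {a b} → a ∧ b ≡ true → a ≡ true × b ≡ true
∧-true⁻ {true} {true} _ = refl , refl

∧-true⁺ : ∀ {a b} → a ≡ true → b ≡ true → a ∧ b ≡ true
∧-true⁺ refl refl = refl

∨-true⁻ : ∀ {a b} → a ∨ b ≡ true → a ≡ true ⊎ b ≡ true
∨-true⁻ {true}  _ = inj₁ refl
∨-true⁻ {false} h = inj₂ h

∨-trueˡ : ∀ {a} b → a ≡ true → a ∨ b ≡ true
∨-trueˡ b refl = refl

∨-trueʳ : ∀ a {b} → b ≡ true → a ∨ b ≡ true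
∨-trueʳ true  _ = refl
∨-trueʳ false h = h

≡true-ext : ∀ {a b} → (a ≡ true → b ≡ true) → (b ≡ true → a ≡ true) → a ≡ b
≡true-ext {true}  {true}  _ _ = refl
≡true-ext {true}  {false} f _ = sym (f refl)
≡true-ext {false} {true}  _ g = g refl
≡true-ext {false} {false} _ _ = refl

∨-redundantʳ : ∀ a b → (b ≡ true → a ≡ true) → a ∨ b ≡ a
∨-redundantʳ true  b _ = refl
∨-redundantʳ false b h with b
... | true  = sym (h refl)
... | false = refl

true≢false : true ≢ false
true≢false ()

true-or-false : ∀ b → b ≡ true ⊎ b ≡ false
true-or-false true  = inj₁ refl
true-or-false false = inj₂ refl

does-true⇒ : ∀ {A : Set} (a? : Dec A) → does a? ≡ true → A
does-true⇒ (yes a) _ = a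

𝟙 : Bool → ℚ
𝟙 b = if b then 1ℚ else 0ℚ

𝟙-∧ : ∀ a b → 𝟙 (a ∧ b) ≡ 𝟙 a * 𝟙 b
𝟙-∧ true  b = sym (*-identityˡ (𝟙 b))
𝟙-∧ false b = sym (*-zeroˡ (𝟙 b))

if-false-1 : ∀ {b} (x : ℚ) → b ≡ false → (if b then x else 1ℚ) ≡ 1ℚ
if-false-1 x refl = refl

if-then-0-* : ∀ b (x y : ℚ) → (if b then x else 0ℚ) * y ≡ (if b then x * y else 0ℚ)
if-then-0-* true  x y = refl
if-then-0-* false x y = *-zeroˡ y

square-one-cancel : ∀ p e → e * e ≡ 1ℚ → p * e ≡ 0ℚ → p ≡ 0ℚ
square-one-cancel p e sq pe≡0 = begin
  p            ≡⟨ *-identityʳ p ⟨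
  p * 1ℚ       ≡⟨ cong (p *_) sq ⟨
  p * (e * e)  ≡⟨ *-assoc p e e ⟨
  p * e * e    ≡⟨ cong (_* e) pe≡0 ⟩
  0ℚ * e       ≡⟨ *-zeroˡ e ⟩
  0ℚ           ∎
  where open ≡-Reasoning

square-one-sandwich : ∀ e x → e * e ≡ 1ℚ → x ≡ e * x * e
square-one-sandwich e x sq = begin
  x            ≡⟨ *-identityʳ x ⟨
  x * 1ℚ       ≡⟨ cong (x *_) sq ⟨
  x * (e * e)  ≡⟨ solve 2 (λ e x → x :* (e :* e) := e :* x :* e) refl e x ⟩
  e * x * e    ∎
  where open ≡-Reasoning

square-one-solve : ∀ s x R → s * s ≡ 1ℚ → s * x + R ≡ 0ℚ → - s * R ≡ x
square-one-solve s x R sq h = begin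
  - s * R                          ≡⟨ solve 3 (λ s x R → :- s :* R := s :* s :* x :- s :* (s :* x :+ R)) refl s x R ⟩
  s * s * x - s * (s * x + R)      ≡⟨ cong₂ (λ p q → p * x - s * q) sq h ⟩
  1ℚ * x - s * 0ℚ                  ≡⟨ solve 2 (λ s x → con 1ℚ :* x :- s :* con 0ℚ := x) refl s x ⟩
  x                                ∎
  where open ≡-Reasoning

signℚ-+ : ∀ a b → signℚ (a ℕ.+ b) ≡ signℚ a * signℚ b
signℚ-+ zero    b = sym (*-identityˡ (signℚ b))
signℚ-+ (suc a) b = trans (cong -_ (signℚ-+ a b)) (neg-* (signℚ a) (signℚ b))
  where
  neg-* : ∀ x y → - (x * y) ≡ - x * y
  neg-* = solve 2 (λ x y → :- (x :* y) := (:- x) :* y) refl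

signℚ-sq : ∀ a → signℚ a * signℚ a ≡ 1ℚ
signℚ-sq zero    = refl
signℚ-sq (suc a) = trans (neg-sq (signℚ a)) (signℚ-sq a)
  where
  neg-sq : ∀ x → - x * - x ≡ x * x
  neg-sq = solve 1 (λ x → (:- x) :* (:- x) := x :* x) refl

-- Finite sums and products

module _ {A : Set} where

  sumList-cong : (L : List A) {F G : A → ℚ} → (∀ a → F a ≡ G a) → sumList L F ≡ sumList L G
  sumList-cong []      h = refl
  sumList-cong (a ∷ L) h = cong₂ _+_ (h a) (sumList-cong L h)

  sumList-zero : (L : List A) {F : A → ℚ} → (∀ a → F a ≡ 0ℚ) → sumList L F ≡ 0ℚ
  sumList-zero []      h = refl
  sumList-zero (a ∷ L) h = cong₂ _+_ (h a) (sumList-zero L h)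

  sumList-+ : (L : List A) (F G : A → ℚ) →
    sumList L (λ a → F a + G a) ≡ sumList L F + sumList L G
  sumList-+ []      F G = refl
  sumList-+ (a ∷ L) F G = trans (cong (F a + G a +_) (sumList-+ L F G))
    (solve 4 (λ x y z w → (x :+ y) :+ (z :+ w) := (x :+ z) :+ (y :+ w)) refl
      (F a) (G a) (sumList L F) (sumList L G))

  sumList-*ˡ : (L : List A) (k : ℚ) (F : A → ℚ) → sumList L (λ a → k * F a) ≡ k * sumList L F
  sumList-*ˡ []      k F = sym (*-zeroʳ k)
  sumList-*ˡ (a ∷ L) k F = trans (cong (k * F a +_) (sumList-*ˡ L k F))
    (solve 3 (λ k x y → k :* x :+ k :* y := k :* (x :+ y)) refl k (F a) (sumList L F))

  sumList-*ʳ : (L : List A) (k : ℚ) (F : A → ℚ) → sumList L (λ a → F a * k) ≡ sumList L F * k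
  sumList-*ʳ L k F = trans (sumList-cong L (λ a → *-comm (F a) k))
    (trans (sumList-*ˡ L k F) (*-comm k _))

  sumList-++ : (L M : List A) (F : A → ℚ) → sumList (L ++ M) F ≡ sumList L F + sumList M F
  sumList-++ []      M F = sym (+-identityˡ _)
  sumList-++ (a ∷ L) M F = trans (cong (F a +_) (sumList-++ L M F))
    (solve 3 (λ x y z → x :+ (y :+ z) := (x :+ y) :+ z) refl (F a) (sumList L F) (sumList M F))

sumList-map : {A B : Set} (f : A → B) (L : List A) (F : B → ℚ) →
  sumList (List.map f L) F ≡ sumList L (F ∘ f)
sumList-map f []      F = refl
sumList-map f (a ∷ L) F = cong (F (f a) +_) (sumList-map f L F)

sumList-comm : {A B : Set} (L : List A) (M : List B) (F : A → B → ℚ) →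
  sumList L (λ a → sumList M (F a)) ≡ sumList M (λ b → sumList L (λ a → F a b))
sumList-comm []      M F = sym (sumList-zero M (λ _ → refl))
sumList-comm (a ∷ L) M F = trans (cong (sumList M (F a) +_) (sumList-comm L M F))
  (sym (sumList-+ M (F a) (λ b → sumList L (λ a′ → F a′ b))))

sumList-interchange : {A B : Set} (L : List A) (M : List B) (p q : A → ℚ) (c : B → ℚ) (K : B → A → ℚ) →
  sumList L (λ y → (p y * sumList M (λ x → c x * K x y)) * q y)
    ≡ sumList M (λ x → c x * sumList L (λ y → p y * (K x y * q y)))
sumList-interchange L M p q c K = begin
  sumList L (λ y → (p y * sumList M (λ x → c x * K x y)) * q y)
    ≡⟨ sumList-cong L (λ y → trans (cong (_* q y) (sym (sumList-*ˡ M (p y) (λ x → c x * K x y))))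
                            (trans (sym (sumList-*ʳ M (q y) (λ x → p y * (c x * K x y))))
                                   (sumList-cong M (λ x → reassoc (p y) (c x) (K x y) (q y))))) ⟩
  sumList L (λ y → sumList M (λ x → c x * (p y * (K x y * q y))))
    ≡⟨ sumList-comm L M (λ y x → c x * (p y * (K x y * q y))) ⟩
  sumList M (λ x → sumList L (λ y → c x * (p y * (K x y * q y))))
    ≡⟨ sumList-cong M (λ x → sumList-*ˡ L (c x) (λ y → p y * (K x y * q y))) ⟩
  sumList M (λ x → c x * sumList L (λ y → p y * (K x y * q y))) ∎
  where
  open ≡-Reasoning
  reassoc : ∀ p c k q → p * (c * k) * q ≡ c * (p * (k * q))
  reassoc = solve 4 (λ p c k q → p :* (c :* k) :* q := c :* (p :* (k :* q))) refl

sumFin-cong : (n : ℕ) {F G : Fin n → ℚ} → (∀ i → F i ≡ G i) → sumFin n F ≡ sumFin n G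
sumFin-cong zero    h = refl
sumFin-cong (suc n) h = cong₂ _+_ (h zero) (sumFin-cong n (h ∘ suc))

sumFin-zero : (n : ℕ) {F : Fin n → ℚ} → (∀ i → F i ≡ 0ℚ) → sumFin n F ≡ 0ℚ
sumFin-zero zero    h = refl
sumFin-zero (suc n) h = cong₂ _+_ (h zero) (sumFin-zero n (h ∘ suc))

sumFin-*ˡ : (n : ℕ) (k : ℚ) (F : Fin n → ℚ) → sumFin n (λ i → k * F i) ≡ k * sumFin n F
sumFin-*ˡ zero    k F = sym (*-zeroʳ k)
sumFin-*ˡ (suc n) k F = trans (cong (k * F zero +_) (sumFin-*ˡ n k (F ∘ suc)))
  (solve 3 (λ k x y → k :* x :+ k :* y := k :* (x :+ y)) refl k (F zero) (sumFin n (F ∘ suc)))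

sumFin-*ʳ : (n : ℕ) (k : ℚ) (F : Fin n → ℚ) → sumFin n (λ i → F i * k) ≡ sumFin n F * k
sumFin-*ʳ n k F = trans (sumFin-cong n (λ i → *-comm (F i) k)) (trans (sumFin-*ˡ n k F) (*-comm k _))

sumFin-sumList-comm : {A : Set} (n : ℕ) (L : List A) (F : Fin n → A → ℚ) →
  sumFin n (λ i → sumList L (F i)) ≡ sumList L (λ a → sumFin n (λ i → F i a))
sumFin-sumList-comm zero    L F = sym (sumList-zero L (λ _ → refl))
sumFin-sumList-comm (suc n) L F = trans (cong (sumList L (F zero) +_) (sumFin-sumList-comm n L (F ∘ suc)))
  (sym (sumList-+ L (F zero) (λ a → sumFin n (λ i → F (suc i) a))))

sumFin-pick : (n : ℕ) (F : Fin n → ℚ) (p : Fin n) →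
  sumFin n F ≡ F p + sumFin n (updateAt F p (const 0ℚ))
sumFin-pick (suc n) F zero    = cong (F zero +_) (sym (+-identityˡ _))
sumFin-pick (suc n) F (suc p) = trans (cong (F zero +_) (sumFin-pick n (F ∘ suc) p))
  (solve 3 (λ x y z → x :+ (y :+ z) := y :+ (x :+ z)) refl (F zero) (F (suc p)) _)

prodFin-cong : (n : ℕ) {F G : Fin n → ℚ} → (∀ i → F i ≡ G i) → prodFin n F ≡ prodFin n G
prodFin-cong zero    h = refl
prodFin-cong (suc n) h = cong₂ _*_ (h zero) (prodFin-cong n (h ∘ suc))

prodFin-one : (n : ℕ) {F : Fin n → ℚ} → (∀ i → F i ≡ 1ℚ) → prodFin n F ≡ 1ℚ
prodFin-one zero    h = refl
prodFin-one (suc n) h = cong₂ _*_ (h zero) (prodFin-one n (h ∘ suc))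

prodFin-* : (n : ℕ) (F G : Fin n → ℚ) → prodFin n (λ i → F i * G i) ≡ prodFin n F * prodFin n G
prodFin-* zero    F G = refl
prodFin-* (suc n) F G = trans (cong (F zero * G zero *_) (prodFin-* n (F ∘ suc) (G ∘ suc)))
  (solve 4 (λ x y z w → (x :* y) :* (z :* w) := (x :* z) :* (y :* w)) refl
    (F zero) (G zero) (prodFin n (F ∘ suc)) (prodFin n (G ∘ suc)))

prodFin-pick : (n : ℕ) (F : Fin n → ℚ) (p : Fin n) →
  prodFin n F ≡ F p * prodFin n (updateAt F p (const 1ℚ))
prodFin-pick (suc n) F zero    = cong (F zero *_) (sym (*-identityˡ _))
prodFin-pick (suc n) F (suc p) = trans (cong (F zero *_) (prodFin-pick n (F ∘ suc) p))
  (solve 3 (λ x y z → x :* (y :* z) := y :* (x :* z)) refl (F zero) (F (suc p)) _)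

prodFin-zero : (n : ℕ) (F : Fin n → ℚ) (p : Fin n) → F p ≡ 0ℚ → prodFin n F ≡ 0ℚ
prodFin-zero n F p h = trans (prodFin-pick n F p) (trans (cong (_* rest) h) (*-zeroˡ rest))
  where rest = prodFin n (updateAt F p (const 1ℚ))

𝟙ℕ : Bool → ℕ
𝟙ℕ b = if b then 1 else 0

countFin-cong : ∀ n {P Q : Fin n → Bool} → (∀ i → P i ≡ Q i) → countFin n P ≡ countFin n Q
countFin-cong zero    h = refl
countFin-cong (suc n) h = cong₂ ℕ._+_ (cong 𝟙ℕ (h zero)) (countFin-cong n (h ∘ suc))

countFin-pick : ∀ n (P : Fin n → Bool) p → countFin n P ≡ 𝟙ℕ (P p) ℕ.+ countFin n (updateAt P p (const false))
countFin-pick (suc n) P zero    = refl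
countFin-pick (suc n) P (suc p) = trans (cong (𝟙ℕ (P zero) ℕ.+_) (countFin-pick n (P ∘ suc) p))
  (+-x∙yz≈y∙xz (𝟙ℕ (P zero)) (𝟙ℕ (P (suc p))) _)

signℚ-<-swap : ∀ {n} (i j : Fin n) → i ≢ j → signℚ (𝟙ℕ (does (i <? j))) * signℚ (𝟙ℕ (does (j <? i))) ≡ - 1ℚ
signℚ-<-swap i j i≢j with Finₚ.<-cmp i j
... | tri< i<j _ _ rewrite dec-true (i <? j) i<j | dec-false (j <? i) (ℕₚ.<⇒≯ i<j) = refl
... | tri≈ _ i≡j _ = ⊥-elim (i≢j i≡j)
... | tri> _ _ j<i rewrite dec-false (i <? j) (ℕₚ.<⇒≯ j<i) | dec-true (j <? i) j<i = refl

_⊆ᵇ_ : ∀ {n} → Vec Bool n → Vec Bool n → Set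
p ⊆ᵇ q = ∀ i → lookup p i ≡ true → lookup q i ≡ true

⊆ᵇ-or-escapes : ∀ {n} (p q : Vec Bool n) → p ⊆ᵇ q ⊎ ∃ λ i → lookup p i ≡ true × lookup q i ≡ false
⊆ᵇ-or-escapes []      []      = inj₁ (λ ())
⊆ᵇ-or-escapes (x ∷ p) (y ∷ q) with ⊆ᵇ-or-escapes p q | x | y
... | inj₂ (i , pi , qi) | _     | _     = inj₂ (suc i , pi , qi)
... | inj₁ p⊆q           | true  | false = inj₂ (zero , refl , refl)
... | inj₁ p⊆q           | true  | true  = inj₁ λ { zero _ → refl ; (suc i) → p⊆q i }
... | inj₁ p⊆q           | false | _     = inj₁ λ { (suc i) → p⊆q i }

⊂ᵇ-∣<∣ : ∀ {n} (p q : Subset n) → p ⊆ᵇ q → ∀ i → lookup p i ≡ false → lookup q i ≡ true → ∣ p ∣ < ∣ q ∣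
⊂ᵇ-∣<∣ p q p⊆q i pi qi = Subsetₚ.p⊂q⇒∣p∣<∣q∣ {p = p} {q}
  ( (λ {x} x∈p → Vecₚ.lookup⇒[]= x q (p⊆q x (Vecₚ.[]=⇒lookup x∈p)))
  , i , Vecₚ.lookup⇒[]= i q qi , λ i∈p → true≢false (trans (sym (Vecₚ.[]=⇒lookup i∈p)) pi))

update-restore : ∀ {n} (t : Vec Bool n) e {b b′} → lookup t e ≡ b → (t [ e ]≔ b′) [ e ]≔ b ≡ t
update-restore t e {b} {b′} te = trans (Vecₚ.[]≔-idempotent t e)
  (trans (cong (t [ e ]≔_) (sym te)) (Vecₚ.[]≔-lookup t e))

∣∣-insert : ∀ {n} (s : Subset n) e → lookup s e ≡ false → ∣ s [ e ]≔ true ∣ ≡ suc ∣ s ∣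
∣∣-insert (false ∷ s) zero    h = refl
∣∣-insert (true  ∷ s) (suc e) h = cong suc (∣∣-insert s e h)
∣∣-insert (false ∷ s) (suc e) h = ∣∣-insert s e h

allFin : ∀ {n} → (Fin n → Bool) → Bool
allFin {zero}  P = true
allFin {suc n} P = P zero ∧ allFin (P ∘ suc)

allFin⁻ : ∀ {n} (P : Fin n → Bool) → allFin P ≡ true → ∀ i → P i ≡ true
allFin⁻ P h zero    = proj₁ (∧-true⁻ {P zero} h)
allFin⁻ P h (suc i) = allFin⁻ (P ∘ suc) (proj₂ (∧-true⁻ {P zero} h)) i

allFin⁺ : ∀ {n} (P : Fin n → Bool) → (∀ i → P i ≡ true) → allFin P ≡ true
allFin⁺ {zero}  P h = refl
allFin⁺ {suc n} P h = ∧-true⁺ (h zero) (allFin⁺ (P ∘ suc) (h ∘ suc))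

𝟙-allFin-* : ∀ {n} (P : Fin n → Bool) (F : Fin n → ℚ) →
  𝟙 (allFin P) * prodFin n F ≡ prodFin n (λ v → 𝟙 (P v) * F v)
𝟙-allFin-* {zero}  P F = refl
𝟙-allFin-* {suc n} P F = begin
  𝟙 (P zero ∧ allFin (P ∘ suc)) * (F zero * prodFin n (F ∘ suc))
    ≡⟨ cong (_* _) (𝟙-∧ (P zero) (allFin (P ∘ suc))) ⟩
  (𝟙 (P zero) * 𝟙 (allFin (P ∘ suc))) * (F zero * prodFin n (F ∘ suc))
    ≡⟨ solve 4 (λ p q x y → (p :* q) :* (x :* y) := (p :* x) :* (q :* y)) refl
         (𝟙 (P zero)) (𝟙 (allFin (P ∘ suc))) (F zero) (prodFin n (F ∘ suc)) ⟩
  (𝟙 (P zero) * F zero) * (𝟙 (allFin (P ∘ suc)) * prodFin n (F ∘ suc))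
    ≡⟨ cong (𝟙 (P zero) * F zero *_) (𝟙-allFin-* (P ∘ suc) (F ∘ suc)) ⟩
  (𝟙 (P zero) * F zero) * prodFin n (λ v → 𝟙 (P (suc v)) * F (suc v)) ∎
  where open ≡-Reasoning

lastIndex : ∀ {n} → (Fin (suc n) → Bool) → Fin (suc n)
lastIndex {zero}  P = zero
lastIndex {suc n} P = if P (suc c) then suc c else zero
  where c = lastIndex (P ∘ suc)

lastIndex-spec : ∀ {n} (P : Fin (suc n) → Bool) x → P x ≡ true →
  P (lastIndex P) ≡ true × toℕ x ≤ toℕ (lastIndex P)
lastIndex-spec {zero}  P zero h = h , z≤n
lastIndex-spec {suc n} P x h with P (suc (lastIndex (P ∘ suc))) in eq | x
... | true  | zero   = eq , z≤n
... | true  | suc x′ = eq , s≤s (proj₂ (lastIndex-spec (P ∘ suc) x′ h))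
... | false | zero   = h , z≤n
... | false | suc x′ = ⊥-elim (true≢false (trans (sym (proj₁ (lastIndex-spec (P ∘ suc) x′ h))) eq))

-- The index d only witnesses that Fin n is inhabited.
largest : ∀ {n} → (Fin n → Bool) → Fin n → Fin n
largest {suc n} P d = lastIndex P

largest-spec : ∀ {n} (P : Fin n → Bool) d x → P x ≡ true →
  P (largest P d) ≡ true × toℕ x ≤ toℕ (largest P d)
largest-spec {suc n} P d = lastIndex-spec P

largest-cong : ∀ {n} {P Q : Fin n → Bool} d d′ → (∀ x → P x ≡ Q x) → P d ≡ true →
  largest P d ≡ largest Q d′
largest-cong {P = P} {Q} d d′ P≗Q Pd = Finₚ.toℕ-injective (ℕₚ.≤-antisym
  (proj₂ (largest-spec Q d′ (largest P d) (trans (sym (P≗Q _)) (proj₁ (largest-spec P d d Pd)))))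
  (proj₂ (largest-spec P d (largest Q d′) (trans (P≗Q _) Qmax))))
  where Qmax = proj₁ (largest-spec Q d′ d (trans (sym (P≗Q d)) Pd))

-- Labels, characters and labellings

sumLabel : (Label → ℚ) → ℚ
sumLabel f = f one + f ex

eqL-refl : ∀ a → eqL a a ≡ true
eqL-refl one = refl
eqL-refl ex  = refl

eqL⇒≡ : ∀ a b → eqL a b ≡ true → a ≡ b
eqL⇒≡ one one _ = refl
eqL⇒≡ ex  ex  _ = refl

eqL-comm : ∀ a b → eqL a b ≡ eqL b a
eqL-comm one one = refl
eqL-comm one ex  = refl
eqL-comm ex  one = refl
eqL-comm ex  ex  = refl

eqL-ex-injective : ∀ a b → eqL a ex ≡ eqL b ex → a ≡ b
eqL-ex-injective one one _ = refl
eqL-ex-injective ex  ex  _ = refl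

-- Labels take only two values.
eqL-both-differ : ∀ a b c d → eqL a b ≡ false → eqL c d ≡ false → eqL a c ≡ eqL b d
eqL-both-differ one ex  one ex  _ _ = refl
eqL-both-differ one ex  ex  one _ _ = refl
eqL-both-differ ex  one one ex  _ _ = refl
eqL-both-differ ex  one ex  one _ _ = refl

label : Bool → Label
label b = if b then ex else one

eqL-label : ∀ x y → x ≢ y → eqL (label x) (label y) ≡ false
eqL-label true  true  x≢y = ⊥-elim (x≢y refl)
eqL-label true  false _   = refl
eqL-label false true  _   = refl
eqL-label false false x≢y = ⊥-elim (x≢y refl)

eqL-label-not : ∀ a b → eqL a (label b) ≡ false → a ≡ label (not b)
eqL-label-not one true  _ = refl
eqL-label-not ex  false _ = refl

eqVecL-comm : ∀ {n} (X Y : Vec Label n) → eqVecL X Y ≡ eqVecL Y X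
eqVecL-comm []      []      = refl
eqVecL-comm (a ∷ X) (b ∷ Y) = cong₂ _∧_ (eqL-comm a b) (eqVecL-comm X Y)

eqVecL-refl : ∀ {n} (X : Vec Label n) → eqVecL X X ≡ true
eqVecL-refl []      = refl
eqVecL-refl (a ∷ X) rewrite eqL-refl a = eqVecL-refl X

eqVecL⇒≡ : ∀ {n} (X Y : Vec Label n) → eqVecL X Y ≡ true → X ≡ Y
eqVecL⇒≡ []      []      _ = refl
eqVecL⇒≡ (a ∷ X) (b ∷ Y) h with ∧-true⁻ {eqL a b} h
... | ha , hX = cong₂ _∷_ (eqL⇒≡ a b ha) (eqVecL⇒≡ X Y hX)

eqVecL-false : ∀ {n} (X Y : Vec Label n) → eqVecL X Y ≡ false → ∃ λ v → eqL (lookup X v) (lookup Y v) ≡ false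
eqVecL-false []      []      ()
eqVecL-false (a ∷ X) (b ∷ Y) h with eqL a b in ab
... | false = zero , ab
... | true  = let v , hv = eqVecL-false X Y h in suc v , hv

-- χ k y is the value at the basis element y of the character 𝒞 → ℚ sending x to 1 (k = one)
-- or to -1 (k = ex); the table is symmetric.
χ : Label → Label → ℚ
χ one _   = 1ℚ
χ ex  one = 1ℚ
χ ex  ex  = - 1ℚ

χ-mulL : ∀ a b k → χ (mulL a b) k ≡ χ a k * χ b k
χ-mulL one b   k   = sym (*-identityˡ (χ b k))
χ-mulL ex  one one = refl
χ-mulL ex  one ex  = refl
χ-mulL ex  ex  one = refl
χ-mulL ex  ex  ex  = refl

χ-orthogonal : ∀ a b → sumLabel (λ y → χ a y * (½ * χ y b)) ≡ 𝟙 (eqL a b)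
χ-orthogonal one one = refl
χ-orthogonal one ex  = refl
χ-orthogonal ex  one = refl
χ-orthogonal ex  ex  = refl

χ-orthogonal′ : ∀ a b → sumLabel (λ y → ½ * χ a y * χ y b) ≡ 𝟙 (eqL a b)
χ-orthogonal′ one one = refl
χ-orthogonal′ one ex  = refl
χ-orthogonal′ ex  one = refl
χ-orthogonal′ ex  ex  = refl

sumLabellings-∷ : (n : ℕ) (F : Vec Label (suc n) → ℚ) →
  sumList (allLabellings (suc n)) F ≡ sumList (allLabellings n) (λ ℓ → F (one ∷ ℓ) + F (ex ∷ ℓ))
sumLabellings-∷ n F = begin
  sumList (Ls (one ∷_) ++ Ls (ex ∷_)) F
    ≡⟨ sumList-++ (Ls (one ∷_)) (Ls (ex ∷_)) F ⟩
  sumList (Ls (one ∷_)) F + sumList (Ls (ex ∷_)) F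
    ≡⟨ cong₂ _+_ (sumList-map (one ∷_) L F) (sumList-map (ex ∷_) L F) ⟩
  sumList L (λ ℓ → F (one ∷ ℓ)) + sumList L (λ ℓ → F (ex ∷ ℓ))
    ≡⟨ sumList-+ L (F ∘ (one ∷_)) (F ∘ (ex ∷_)) ⟨
  sumList L (λ ℓ → F (one ∷ ℓ) + F (ex ∷ ℓ)) ∎
  where
  open ≡-Reasoning
  L = allLabellings n
  Ls : (Vec Label n → Vec Label (suc n)) → List (Vec Label (suc n))
  Ls f = List.map f L

sumLabellings-δ : (n : ℕ) (X : Vec Label n) (F : Vec Label n → ℚ) →
  sumList (allLabellings n) (λ ℓ → if eqVecL X ℓ then F ℓ else 0ℚ) ≡ F X
sumLabellings-δ zero    []      F = +-identityʳ (F [])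
sumLabellings-δ (suc n) (a ∷ X) F = trans (sumLabellings-∷ n _) (at a)
  where
  at : ∀ a → sumList (allLabellings n) (λ ℓ → (if eqVecL (a ∷ X) (one ∷ ℓ) then F (one ∷ ℓ) else 0ℚ)
                                           + (if eqVecL (a ∷ X) (ex ∷ ℓ) then F (ex ∷ ℓ) else 0ℚ))
           ≡ F (a ∷ X)
  at one = trans (sumList-cong (allLabellings n) (λ ℓ → +-identityʳ _)) (sumLabellings-δ n X (F ∘ (one ∷_)))
  at ex  = trans (sumList-cong (allLabellings n) (λ ℓ → +-identityˡ _)) (sumLabellings-δ n X (F ∘ (ex ∷_)))

module _ {n} (ref : Fin (suc n) → Fin (suc n)) (ge : ∀ v → toℕ v ≤ toℕ (ref v)) where

  private
    ref≢0 : ∀ v → zero ≢ ref (suc v)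
    ref≢0 v eq with ge (suc v)
    ... | h rewrite sym eq = ℕₚ.<-irrefl refl (ℕₚ.≤-trans (s≤s z≤n) h)

  tail-ref : Fin n → Fin n
  tail-ref v = punchOut (ref≢0 v)

  suc-tail-ref : ∀ v → suc (tail-ref v) ≡ ref (suc v)
  suc-tail-ref v = Finₚ.punchIn-punchOut (ref≢0 v)

  tail-ref-≥ : ∀ v → toℕ v ≤ toℕ (tail-ref v)
  tail-ref-≥ v = ℕₚ.≤-pred (subst (λ r → suc (toℕ v) ≤ toℕ r) (sym (suc-tail-ref v)) (ge (suc v)))

-- Summing one label at a time from the front: each factor reads only
-- labels at or after its own position, so the first label occurs only in
-- the first factor.
sumLabellings-∏-forward :
  (n : ℕ) (ref : Fin n → Fin n) → (∀ v → toℕ v ≤ toℕ (ref v)) →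
  (f : Fin n → Label → Label → ℚ) (C : Fin n → ℚ) →
  (∀ v → ref v ≡ v → sumLabel (λ x → f v x x) ≡ C v) →
  (∀ v → ref v ≢ v → ∀ y → sumLabel (λ x → f v x y) ≡ C v) →
  sumList (allLabellings n) (λ ℓ → prodFin n (λ v → f v (lookup ℓ v) (lookup ℓ (ref v))))
    ≡ prodFin n C
sumLabellings-∏-forward zero    ref ge f C fixed moved = +-identityʳ 1ℚ
sumLabellings-∏-forward (suc n) ref ge f C fixed moved = begin
  sumList (allLabellings (suc n)) P
    ≡⟨ sumLabellings-∷ n P ⟩
  sumList L (λ ℓ → P (one ∷ ℓ) + P (ex ∷ ℓ))
    ≡⟨ sumList-cong L (λ ℓ → trans (cong₂ _+_ (peel one ℓ) (peel ex ℓ))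
                                   (trans (sym (*-distribʳ-+ (R ℓ) (f₀ ℓ one) (f₀ ℓ ex)))
                                          (cong (_* R ℓ) (head ℓ)))) ⟩
  sumList L (λ ℓ → C zero * R ℓ)
    ≡⟨ sumList-*ˡ L (C zero) R ⟩
  C zero * sumList L R
    ≡⟨ cong (C zero *_) (sumLabellings-∏-forward n ref′ (tail-ref-≥ ref ge) (f ∘ suc) (C ∘ suc) fixed′ moved′) ⟩
  C zero * prodFin n (C ∘ suc) ∎
  where
  open ≡-Reasoning
  L = allLabellings n
  ref′ = tail-ref ref ge

  P : Vec Label (suc n) → ℚ
  P ℓ = prodFin (suc n) (λ v → f v (lookup ℓ v) (lookup ℓ (ref v)))

  R : Vec Label n → ℚ
  R ℓ = prodFin n (λ v → f (suc v) (lookup ℓ v) (lookup ℓ (ref′ v)))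

  f₀ : Vec Label n → Label → ℚ
  f₀ ℓ x = f zero x (lookup (x ∷ ℓ) (ref zero))

  peel : ∀ x ℓ → P (x ∷ ℓ) ≡ f₀ ℓ x * R ℓ
  peel x ℓ = cong (f₀ ℓ x *_) (prodFin-cong n (λ v →
    cong (f (suc v) (lookup ℓ v)) (cong (lookup (x ∷ ℓ)) (sym (suc-tail-ref ref ge v)))))

  head : ∀ ℓ → sumLabel (f₀ ℓ) ≡ C zero
  head ℓ with ref zero in eq
  ... | zero  = fixed zero eq
  ... | suc r = moved zero (λ eq′ → Finₚ.0≢1+n (trans (sym eq′) eq)) (lookup ℓ r)

  fixed′ : ∀ v → ref′ v ≡ v → sumLabel (λ x → f (suc v) x x) ≡ C (suc v)
  fixed′ v eq = fixed (suc v) (trans (sym (suc-tail-ref ref ge v)) (cong suc eq))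

  moved′ : ∀ v → ref′ v ≢ v → ∀ y → sumLabel (λ x → f (suc v) x y) ≡ C (suc v)
  moved′ v ne = moved (suc v) (λ eq → ne (Finₚ.suc-injective (trans (suc-tail-ref ref ge v) eq)))

prodFin-𝟙-eqL : ∀ {n} (X Y : Vec Label n) → prodFin n (λ v → 𝟙 (eqL (lookup X v) (lookup Y v))) ≡ 𝟙 (eqVecL X Y)
prodFin-𝟙-eqL []      []      = refl
prodFin-𝟙-eqL (a ∷ X) (b ∷ Y) = trans (cong (𝟙 (eqL a b) *_) (prodFin-𝟙-eqL X Y)) (sym (𝟙-∧ (eqL a b) (eqVecL X Y)))

module _ (Γ : Graph) where
  open Graph Γ

  -- Connected components

  anyFin-true⁻ : ∀ {k} (f : Fin k → Bool) → anyFin Γ f ≡ true → ∃ λ i → f i ≡ true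
  anyFin-true⁻ {suc k} f h with ∨-true⁻ {f zero} h
  ... | inj₁ f0 = zero , f0
  ... | inj₂ fs = let i , fi = anyFin-true⁻ (f ∘ suc) fs in suc i , fi

  anyFin-true⁺ : ∀ {k} (f : Fin k → Bool) i → f i ≡ true → anyFin Γ f ≡ true
  anyFin-true⁺ f zero    h = ∨-trueˡ _ h
  anyFin-true⁺ f (suc i) h = ∨-trueʳ (f zero) (anyFin-true⁺ (f ∘ suc) i h)

  =ᵛ⇒≡ : ∀ {u v} → _=ᵛ_ Γ u v ≡ true → u ≡ v
  =ᵛ⇒≡ {u} {v} = does-true⇒ (u ≟ v)

  =ᵛ-refl : ∀ u → _=ᵛ_ Γ u u ≡ true
  =ᵛ-refl u = dec-true (u ≟ u) refl

  Carries : State Γ → Subset nV → Fin nE → Fin nV → Bool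
  Carries s R e w = lookup s e ∧
    ((lookup R (src Γ e) ∧ (_=ᵛ_ Γ (tgt Γ e) w)) ∨ (lookup R (tgt Γ e) ∧ (_=ᵛ_ Γ (src Γ e) w)))

  Carried : State Γ → Subset nV → Fin nE → Fin nV → Set
  Carried s R e w = lookup s e ≡ true ×
    ((lookup R (src Γ e) ≡ true × tgt Γ e ≡ w) ⊎ (lookup R (tgt Γ e) ≡ true × src Γ e ≡ w))

  carries⁻ : ∀ s R e w → Carries s R e w ≡ true → Carried s R e w
  carries⁻ s R e w c with ∧-true⁻ {lookup s e} c
  ... | se , ends with ∨-true⁻ {lookup R (src Γ e) ∧ _} ends
  ... | inj₁ fwd = let Ra , bw = ∧-true⁻ {lookup R (src Γ e)} fwd in se , inj₁ (Ra , =ᵛ⇒≡ bw)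
  ... | inj₂ bwd = let Rb , aw = ∧-true⁻ {lookup R (tgt Γ e)} bwd in se , inj₂ (Rb , =ᵛ⇒≡ aw)

  carries⁺ : ∀ s R e w → Carried s R e w → Carries s R e w ≡ true
  carries⁺ s R e w (se , inj₁ (Ra , refl)) = ∧-true⁺ se (∨-trueˡ _ (∧-true⁺ Ra (=ᵛ-refl (tgt Γ e))))
  carries⁺ s R e w (se , inj₂ (Rb , refl)) =
    ∧-true⁺ se (∨-trueʳ (lookup R (src Γ e) ∧ _) (∧-true⁺ Rb (=ᵛ-refl (src Γ e))))

  step⁻ : ∀ s R w → lookup (step Γ s R) w ≡ true → lookup R w ≡ true ⊎ ∃ λ e → Carried s R e w
  step⁻ s R w h with ∨-true⁻ {lookup R w} (trans (sym (Vecₚ.lookup∘tabulate _ w)) h)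
  ... | inj₁ Rw      = inj₁ Rw
  ... | inj₂ carried = let e , c = anyFin-true⁻ _ carried in inj₂ (e , carries⁻ s R e w c)

  step⁺ : ∀ s R w → lookup R w ≡ true ⊎ ∃ (λ e → Carried s R e w) → lookup (step Γ s R) w ≡ true
  step⁺ s R w (inj₁ Rw) = trans (Vecₚ.lookup∘tabulate _ w) (∨-trueˡ _ Rw)
  step⁺ s R w (inj₂ (e , c)) = trans (Vecₚ.lookup∘tabulate _ w)
    (∨-trueʳ (lookup R w) (anyFin-true⁺ (λ e → Carries s R e w) e (carries⁺ s R e w c)))

  step-inflationary : ∀ s R → R ⊆ᵇ step Γ s R
  step-inflationary s R w h = step⁺ s R w (inj₁ h)

  step-mono : ∀ s s′ R R′ → s ⊆ᵇ s′ → R ⊆ᵇ R′ → step Γ s R ⊆ᵇ step Γ s′ R′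
  step-mono s s′ R R′ s⊆s′ R⊆R′ w h = step⁺ s′ R′ w (widen (step⁻ s R w h))
    where
    widen : _ → _
    widen (inj₁ Rw)                        = inj₁ (R⊆R′ w Rw)
    widen (inj₂ (e , se , inj₁ (Ra , bw))) = inj₂ (e , s⊆s′ e se , inj₁ (R⊆R′ _ Ra , bw))
    widen (inj₂ (e , se , inj₂ (Rb , aw))) = inj₂ (e , s⊆s′ e se , inj₂ (R⊆R′ _ Rb , aw))

  iter-mono : ∀ k s s′ R R′ → s ⊆ᵇ s′ → R ⊆ᵇ R′ → iter Γ k s R ⊆ᵇ iter Γ k s′ R′
  iter-mono zero    s s′ R R′ s⊆s′ R⊆R′ = R⊆R′
  iter-mono (suc k) s s′ R R′ s⊆s′ R⊆R′ =
    step-mono s s′ (iter Γ k s R) (iter Γ k s′ R′) s⊆s′ (iter-mono k s s′ R R′ s⊆s′ R⊆R′)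

  iter-inflationary : ∀ k s R → R ⊆ᵇ iter Γ k s R
  iter-inflationary zero    s R w h = h
  iter-inflationary (suc k) s R w h = step-inflationary s (iter Γ k s R) w (iter-inflationary k s R w h)

  Closed : State Γ → Subset nV → Set
  Closed s R = step Γ s R ⊆ᵇ R

  -- Until breadth-first search stabilises, every step adds a vertex.
  iter-closed-or-large : ∀ k s R → Closed s (iter Γ k s R) ⊎ k ≤ ∣ iter Γ k s R ∣
  iter-closed-or-large zero    s R = inj₂ z≤n
  iter-closed-or-large (suc k) s R with iter-closed-or-large k s R
  ... | inj₁ closed = inj₁ (step-mono s s (step Γ s (iter Γ k s R)) (iter Γ k s R) (λ _ h → h) closed)
  ... | inj₂ large with ⊆ᵇ-or-escapes (step Γ s (iter Γ k s R)) (iter Γ k s R)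
  ... | inj₁ closed = inj₁ (step-mono s s (step Γ s (iter Γ k s R)) (iter Γ k s R) (λ _ h → h) closed)
  ... | inj₂ (w , new , old) = inj₂ (ℕₚ.≤-trans (s≤s large)
        (⊂ᵇ-∣<∣ (iter Γ k s R) (step Γ s (iter Γ k s R)) (step-inflationary s (iter Γ k s R)) w old new))

  component-closed : ∀ s u → Closed s (component Γ s u)
  component-closed s u with iter-closed-or-large nV s (singleton Γ u)
  ... | inj₁ closed = closed
  ... | inj₂ large = λ w _ → subst (λ R → lookup R w ≡ true) (sym full) (Vecₚ.lookup-replicate w true)
    where
    full : component Γ s u ≡ ⊤
    full = Subsetₚ.∣p∣≡n⇒p≡⊤ (ℕₚ.≤-antisym (Subsetₚ.∣p∣≤n (component Γ s u)) large)

  lookup-singleton : ∀ u w → lookup (singleton Γ u) w ≡ _=ᵛ_ Γ u w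
  lookup-singleton u w = Vecₚ.lookup∘tabulate (_=ᵛ_ Γ u) w

  sameComp-refl : ∀ s u → sameComp Γ s u u ≡ true
  sameComp-refl s u = iter-inflationary nV s (singleton Γ u) u (trans (lookup-singleton u u) (=ᵛ-refl u))

  sameComp-invariant : ∀ {A : Set} s (P : Fin nV → A) → (∀ e → lookup s e ≡ true → P (src Γ e) ≡ P (tgt Γ e)) →
    ∀ u w → sameComp Γ s u w ≡ true → P w ≡ P u
  sameComp-invariant s P P-edge u = reach nV
    where
    reach : ∀ k w → lookup (iter Γ k s (singleton Γ u)) w ≡ true → P w ≡ P u
    reach zero    w h = cong P (sym (=ᵛ⇒≡ (trans (sym (lookup-singleton u w)) h)))
    reach (suc k) w h with step⁻ s (iter Γ k s (singleton Γ u)) w h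
    ... | inj₁ old                         = reach k w old
    ... | inj₂ (e , se , inj₁ (Ra , refl)) = trans (sym (P-edge e se)) (reach k _ Ra)
    ... | inj₂ (e , se , inj₂ (Rb , refl)) = trans (P-edge e se) (reach k _ Rb)

  sameComp-edge : ∀ s e → lookup s e ≡ true → ∀ u → sameComp Γ s u (src Γ e) ≡ sameComp Γ s u (tgt Γ e)
  sameComp-edge s e se u = ≡true-ext
    (λ h → component-closed s u _ (step⁺ s (component Γ s u) _ (inj₂ (e , se , inj₁ (h , refl)))))
    (λ h → component-closed s u _ (step⁺ s (component Γ s u) _ (inj₂ (e , se , inj₂ (h , refl)))))

  sameComp-shift : ∀ s u v w → sameComp Γ s v w ≡ true → sameComp Γ s u w ≡ sameComp Γ s u v
  sameComp-shift s u = sameComp-invariant s (sameComp Γ s u) (λ e se → sameComp-edge s e se u)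

  sameComp-sym : ∀ s u v → sameComp Γ s u v ≡ true → sameComp Γ s v u ≡ true
  sameComp-sym s u v h = trans (sym (sameComp-shift s v u v h)) (sameComp-refl s v)

  sameComp-trans : ∀ s u v w → sameComp Γ s u v ≡ true → sameComp Γ s v w ≡ true → sameComp Γ s u w ≡ true
  sameComp-trans s u v w uv vw = trans (sameComp-shift s u v w vw) uv

  sameComp-mono : ∀ {s s′} → s ⊆ᵇ s′ → ∀ u v → sameComp Γ s u v ≡ true → sameComp Γ s′ u v ≡ true
  sameComp-mono {s} {s′} s⊆s′ u = iter-mono nV s s′ (singleton Γ u) (singleton Γ u) s⊆s′ (λ _ h → h)

  sameComp-ends : ∀ s e → lookup s e ≡ true → sameComp Γ s (src Γ e) (tgt Γ e) ≡ true
  sameComp-ends s e se = trans (sym (sameComp-edge s e se (src Γ e))) (sameComp-refl s (src Γ e))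

  sameComp-comm : ∀ s u v → sameComp Γ s u v ≡ sameComp Γ s v u
  sameComp-comm s u v = ≡true-ext (sameComp-sym s u v) (sameComp-sym s v u)

  sameComp-≗ : ∀ s u v → sameComp Γ s u v ≡ true → ∀ w → sameComp Γ s u w ≡ sameComp Γ s v w
  sameComp-≗ s u v uv w = ≡true-ext (sameComp-trans s v u w (sameComp-sym s u v uv)) (sameComp-trans s u v w uv)

  -- Representatives and products over components

  rep : State Γ → Fin nV → Fin nV
  rep s v = largest (sameComp Γ s v) v

  rep-sameComp : ∀ s v → sameComp Γ s v (rep s v) ≡ true
  rep-sameComp s v = proj₁ (largest-spec (sameComp Γ s v) v v (sameComp-refl s v))

  rep-≥ : ∀ s v → toℕ v ≤ toℕ (rep s v)
  rep-≥ s v = proj₂ (largest-spec (sameComp Γ s v) v v (sameComp-refl s v))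

  rep-≗ : ∀ s t v → (∀ w → sameComp Γ t v w ≡ sameComp Γ s v w) → rep t v ≡ rep s v
  rep-≗ s t v t≗s = largest-cong v v t≗s (sameComp-refl t v)

  rep-cong : ∀ s u v → sameComp Γ s u v ≡ true → rep s u ≡ rep s v
  rep-cong s u v uv = largest-cong u v (sameComp-≗ s u v uv) (sameComp-refl s u)

  rep-idem : ∀ s v → rep s (rep s v) ≡ rep s v
  rep-idem s v = sym (rep-cong s v (rep s v) (rep-sameComp s v))

  isRep : State Γ → Fin nV → Bool
  isRep s v = does (rep s v ≟ v)

  isRep-rep : ∀ s v → isRep s (rep s v) ≡ true
  isRep-rep s v = dec-true (rep s (rep s v) ≟ rep s v) (rep-idem s v)

  isRep⇒ : ∀ s v → isRep s v ≡ true → rep s v ≡ v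
  isRep⇒ s v = does-true⇒ (rep s v ≟ v)

  ¬isRep : ∀ s v → rep s v ≢ v → isRep s v ≡ false
  ¬isRep s v = dec-false (rep s v ≟ v)

  isValid : State Γ → Labelling Γ → Bool
  isValid s ℓ = allFin (λ v → eqL (lookup ℓ v) (lookup ℓ (rep s v)))

  isValid⇒rep : ∀ s ℓ → isValid s ℓ ≡ true → ∀ v → lookup ℓ v ≡ lookup ℓ (rep s v)
  isValid⇒rep s ℓ h v = eqL⇒≡ _ _ (allFin⁻ _ h v)

  isValid-intro : ∀ s ℓ → (∀ v → lookup ℓ v ≡ lookup ℓ (rep s v)) → isValid s ℓ ≡ true
  isValid-intro s ℓ h = allFin⁺ _ (λ v → subst (λ x → eqL (lookup ℓ v) x ≡ true) (h v) (eqL-refl _))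

  isValid⇒Valid : ∀ s ℓ → isValid s ℓ ≡ true → Valid Γ s ℓ
  isValid⇒Valid s ℓ h u v uv =
    trans (isValid⇒rep s ℓ h u) (trans (cong (lookup ℓ) (rep-cong s u v uv)) (sym (isValid⇒rep s ℓ h v)))

  Valid⇒isValid : ∀ s ℓ → Valid Γ s ℓ → isValid s ℓ ≡ true
  Valid⇒isValid s ℓ h = isValid-intro s ℓ (λ v → h v (rep s v) (rep-sameComp s v))

  Monochromatic : Labelling Γ → Fin nE → Bool
  Monochromatic κ e = eqL (lookup κ (src Γ e)) (lookup κ (tgt Γ e))

  isValid-edges : ∀ s κ → (∀ e → lookup s e ≡ true → Monochromatic κ e ≡ true) → isValid s κ ≡ true
  isValid-edges s κ mono = isValid-intro s κ (λ v →
    sym (sameComp-invariant s (lookup κ) (λ e se → eqL⇒≡ _ _ (mono e se)) v (rep s v) (rep-sameComp s v)))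

  isValid⇒monochromatic : ∀ s κ → isValid s κ ≡ true → ∀ e → lookup s e ≡ true → Monochromatic κ e ≡ true
  isValid⇒monochromatic s κ h e se =
    subst (λ x → eqL (lookup κ (src Γ e)) x ≡ true) (isValid⇒Valid s κ h _ _ (sameComp-ends s e se)) (eqL-refl _)

  isValid-mono : ∀ {s t} κ → s ⊆ᵇ t → isValid t κ ≡ true → isValid s κ ≡ true
  isValid-mono {s} {t} κ s⊆t h = isValid-edges s κ (λ e se → isValid⇒monochromatic t κ h e (s⊆t e se))

  NoEdges : State Γ → Set
  NoEdges t = ∀ e → lookup t e ≡ false

  ⊥-NoEdges : NoEdges Subset.⊥
  ⊥-NoEdges e = Vecₚ.lookup-replicate e false

  NoEdges-valid : ∀ t κ → NoEdges t → isValid t κ ≡ true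
  NoEdges-valid t κ none = isValid-edges t κ (λ e te → ⊥-elim (true≢false (trans (sym te) (none e))))

  NoEdges-isRep : ∀ t v → NoEdges t → isRep t v ≡ true
  NoEdges-isRep t v none = dec-true (rep t v ≟ v) (sym (=ᵛ⇒≡ (trans
    (sameComp-invariant t (_=ᵛ_ Γ v) (λ e te → ⊥-elim (true≢false (trans (sym te) (none e)))) v (rep t v) (rep-sameComp t v))
    (=ᵛ-refl v))))

  atReps : State Γ → (Fin nV → ℚ) → Fin nV → ℚ
  atReps s F v = if isRep s v then F v else 1ℚ

  ∏ᶜ : State Γ → (Fin nV → ℚ) → ℚ
  ∏ᶜ s F = prodFin nV (atReps s F)

  ∏ᶜ-cong : ∀ s {F G : Fin nV → ℚ} → (∀ v → isRep s v ≡ true → F v ≡ G v) → ∏ᶜ s F ≡ ∏ᶜ s G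
  ∏ᶜ-cong s {F} {G} F≗G = prodFin-cong nV at
    where
    at : ∀ v → (if isRep s v then F v else 1ℚ) ≡ (if isRep s v then G v else 1ℚ)
    at v with isRep s v in r
    ... | true  = F≗G v r
    ... | false = refl

  ∏ᶜ-* : ∀ s F G → ∏ᶜ s F * ∏ᶜ s G ≡ ∏ᶜ s (λ v → F v * G v)
  ∏ᶜ-* s F G = trans (sym (prodFin-* nV _ _)) (prodFin-cong nV at)
    where
    at : ∀ v → (if isRep s v then F v else 1ℚ) * (if isRep s v then G v else 1ℚ)
             ≡ (if isRep s v then F v * G v else 1ℚ)
    at v with isRep s v
    ... | true  = refl
    ... | false = refl

  ∏ᶜ-one : ∀ s {F} → (∀ v → isRep s v ≡ true → F v ≡ 1ℚ) → ∏ᶜ s F ≡ 1ℚ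
  ∏ᶜ-one s {F} F≡1 = trans (∏ᶜ-cong s F≡1) (prodFin-one nV at)
    where
    at : ∀ v → (if isRep s v then 1ℚ else 1ℚ) ≡ 1ℚ
    at v with isRep s v
    ... | true  = refl
    ... | false = refl

  ∏ᶜ-zero : ∀ s F v → F (rep s v) ≡ 0ℚ → ∏ᶜ s F ≡ 0ℚ
  ∏ᶜ-zero s F v h = prodFin-zero nV _ (rep s v)
    (subst (λ b → (if b then F (rep s v) else 1ℚ) ≡ 0ℚ) (sym (isRep-rep s v)) h)

  module Insertion (t : State Γ) (e : Fin nE) (te : lookup t e ≡ true) where

    s : State Γ
    s = t [ e ]≔ false

    a b : Fin nV
    a = src Γ e
    b = tgt Γ e

    s⊆t : s ⊆ᵇ t
    s⊆t e′ h with e′ ≟ e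
    ... | yes refl = te
    ... | no e′≢e  = trans (sym (Vecₚ.lookup∘update′ e′≢e t false)) h

    merged : Fin nV → Bool
    merged v = sameComp Γ s a v ∨ sameComp Γ s b v

    merged⇒sameComp : ∀ v → merged v ≡ true → sameComp Γ t a v ≡ true
    merged⇒sameComp v h with ∨-true⁻ {sameComp Γ s a v} h
    ... | inj₁ av = sameComp-mono s⊆t a v av
    ... | inj₂ bv = sameComp-trans t a b v (sameComp-ends t e te) (sameComp-mono s⊆t b v bv)

    sameComp-insert : ∀ u w → sameComp Γ t u w ≡ (sameComp Γ s u w ∨ (merged u ∧ merged w))
    sameComp-insert u w = ≡true-ext
      (λ uw → trans (sameComp-invariant t P P-edge u w uw) (∨-trueˡ _ (sameComp-refl s u)))
      (λ h → case (∨-true⁻ {sameComp Γ s u w} h))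
      where
      P : Fin nV → Bool
      P x = sameComp Γ s u x ∨ (merged u ∧ merged x)

      absorb : ∀ x y w → x ∨ ((x ∨ y) ∧ true) ≡ y ∨ ((x ∨ y) ∧ (w ∨ true))
      absorb x y w rewrite Boolₚ.∨-zeroʳ w | Boolₚ.∧-identityʳ (x ∨ y) = absorb′ x y
        where
        absorb′ : ∀ x y → x ∨ (x ∨ y) ≡ y ∨ (x ∨ y)
        absorb′ true  true  = refl
        absorb′ true  false = refl
        absorb′ false true  = refl
        absorb′ false false = refl

      P-edge : ∀ e′ → lookup t e′ ≡ true → P (src Γ e′) ≡ P (tgt Γ e′)
      P-edge e′ te′ with e′ ≟ e
      ... | yes refl rewrite sameComp-refl s a | sameComp-refl s b
                           | sameComp-comm s a u | sameComp-comm s b u =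
                             absorb (sameComp Γ s u a) (sameComp Γ s u b) (sameComp Γ s a b)
      ... | no e′≢e = cong₂ _∨_ (sameComp-edge s e′ se′ u)
          (cong (merged u ∧_) (cong₂ _∨_ (sameComp-edge s e′ se′ a) (sameComp-edge s e′ se′ b)))
        where se′ = trans (Vecₚ.lookup∘update′ e′≢e t false) te′

      case : sameComp Γ s u w ≡ true ⊎ (merged u ∧ merged w) ≡ true → sameComp Γ t u w ≡ true
      case (inj₁ uw) = sameComp-mono s⊆t u w uw
      case (inj₂ mm) = let mu , mw = ∧-true⁻ {merged u} mm in
        sameComp-trans t u a w (sameComp-sym t a u (merged⇒sameComp u mu)) (merged⇒sameComp w mw)

    merged-sameComp : ∀ u w → sameComp Γ s u w ≡ true → merged u ≡ merged w
    merged-sameComp u w uw = cong₂ _∨_ (sym (sameComp-shift s a u w uw)) (sym (sameComp-shift s b u w uw))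

    sameComp-insert-inside : sameComp Γ s a b ≡ true → ∀ u w → sameComp Γ t u w ≡ sameComp Γ s u w
    sameComp-insert-inside ab u w = trans (sameComp-insert u w) (∨-redundantʳ _ _ both)
      where
      from-a : ∀ v → merged v ≡ true → sameComp Γ s a v ≡ true
      from-a v mv with ∨-true⁻ {sameComp Γ s a v} mv
      ... | inj₁ av = av
      ... | inj₂ bv = sameComp-trans s a b v ab bv
      both : merged u ∧ merged w ≡ true → sameComp Γ s u w ≡ true
      both mm = let mu , mw = ∧-true⁻ {merged u} mm in
        sameComp-trans s u a w (sameComp-sym s a u (from-a u mu)) (from-a w mw)

    sameComp-insert-outside : ∀ u → merged u ≡ false → ∀ w → sameComp Γ t u w ≡ sameComp Γ s u w
    sameComp-insert-outside u mu w rewrite sameComp-insert u w | mu = Boolₚ.∨-identityʳ _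

    merged-label : Labelling Γ → Labelling Γ
    merged-label ℓ = tabulate λ v → if merged v then mulL (lookup ℓ a) (lookup ℓ b) else lookup ℓ v

    lookup-merged-label : ∀ ℓ v →
      lookup (merged-label ℓ) v ≡ (if merged v then mulL (lookup ℓ a) (lookup ℓ b) else lookup ℓ v)
    lookup-merged-label ℓ = Vecₚ.lookup∘tabulate _

    Tlab-valid : ∀ ℓ → isValid s ℓ ≡ true → isValid t (Tlab Γ s e ℓ) ≡ true
    Tlab-valid ℓ vℓ with sameComp Γ s a b in ab
    ... | true  = Valid⇒isValid t ℓ (λ u w uw →
                    isValid⇒Valid s ℓ vℓ u w (trans (sym (sameComp-insert-inside ab u w)) uw))
    ... | false = Valid⇒isValid t (merged-label ℓ) (λ u w uw →
                    at u w (∨-true⁻ {sameComp Γ s u w} (trans (sym (sameComp-insert u w)) uw)))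
      where
      at : ∀ u w → sameComp Γ s u w ≡ true ⊎ (merged u ∧ merged w) ≡ true →
        lookup (merged-label ℓ) u ≡ lookup (merged-label ℓ) w
      at u w (inj₁ uw) rewrite lookup-merged-label ℓ u | lookup-merged-label ℓ w | merged-sameComp u w uw
        | isValid⇒Valid s ℓ vℓ u w uw = refl
      at u w (inj₂ mm) with ∧-true⁻ {merged u} mm
      ... | mu , mw rewrite lookup-merged-label ℓ u | lookup-merged-label ℓ w | mu | mw = refl

    ∏ᶜ-insert-inside : sameComp Γ s a b ≡ true → ∀ F → ∏ᶜ t F ≡ ∏ᶜ s F
    ∏ᶜ-insert-inside ab F = prodFin-cong nV λ v →
      cong (λ r → if does (r ≟ v) then F v else 1ℚ) (rep-≗ s t v (sameComp-insert-inside ab v))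

    module Merging (a≁b : sameComp Γ s a b ≡ false) where

      m r₁ r₂ : Fin nV
      m  = rep t a
      r₁ = rep s a
      r₂ = rep s b

      merged-r₁ : merged r₁ ≡ true
      merged-r₁ = ∨-trueˡ _ (rep-sameComp s a)

      merged-r₂ : merged r₂ ≡ true
      merged-r₂ = ∨-trueʳ (sameComp Γ s a r₂) (rep-sameComp s b)

      merged-m : merged m ≡ true
      merged-m with ∨-true⁻ {sameComp Γ s a m} (trans (sym (sameComp-insert a m)) (rep-sameComp t a))
      ... | inj₁ am = trans (sym (merged-sameComp a m am)) (∨-trueˡ _ (sameComp-refl s a))
      ... | inj₂ mm = proj₂ (∧-true⁻ {merged a} mm)

      r₁≢r₂ : r₁ ≢ r₂
      r₁≢r₂ eq = true≢false (trans (sym (sameComp-trans s a r₁ b (rep-sameComp s a)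
        (sameComp-sym s b r₁ (subst (λ r → sameComp Γ s b r ≡ true) (sym eq) (rep-sameComp s b))))) a≁b)

      rep-s-merged : ∀ v → merged v ≡ true → rep s v ≡ r₁ ⊎ rep s v ≡ r₂
      rep-s-merged v mv with ∨-true⁻ {sameComp Γ s a v} mv
      ... | inj₁ av = inj₁ (sym (rep-cong s a v av))
      ... | inj₂ bv = inj₂ (sym (rep-cong s b v bv))

      rep-t-merged : ∀ v → merged v ≡ true → rep t v ≡ m
      rep-t-merged v mv = sym (rep-cong t a v (merged⇒sameComp v mv))

      isRep-outside : ∀ v → merged v ≡ false → isRep t v ≡ isRep s v
      isRep-outside v mv = cong (λ r → does (r ≟ v)) (rep-≗ s t v (sameComp-insert-outside v mv))

      apart : ∀ v x → merged v ≡ false → merged x ≡ true → v ≢ x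
      apart v x mv mx refl = true≢false (trans (sym mx) mv)

      one-at-t : ∀ F v → merged v ≡ true → updateAt (atReps t F) m (const 1ℚ) v ≡ 1ℚ
      one-at-t F v mv with v ≟ m
      ... | yes refl = updateAt-updates m (atReps t F)
      ... | no v≢m   = trans (updateAt-minimal v m (atReps t F) v≢m)
                         (if-false-1 (F v) (¬isRep t v (λ eq → v≢m (trans (sym eq) (rep-t-merged v mv)))))

      one-at-s : ∀ G v → merged v ≡ true →
        updateAt (updateAt (atReps s G) r₁ (const 1ℚ)) r₂ (const 1ℚ) v ≡ 1ℚ
      one-at-s G v mv with v ≟ r₂ | v ≟ r₁
      ... | yes refl | _        = updateAt-updates r₂ _
      ... | no v≢r₂  | yes refl = trans (updateAt-minimal r₁ r₂ _ v≢r₂) (updateAt-updates r₁ (atReps s G))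
      ... | no v≢r₂  | no v≢r₁  = trans (updateAt-minimal v r₂ _ v≢r₂)
          (trans (updateAt-minimal v r₁ (atReps s G) v≢r₁) (if-false-1 (G v) (¬isRep s v not-rep)))
        where
        not-rep : rep s v ≢ v
        not-rep eq with rep-s-merged v mv
        ... | inj₁ e₁ = v≢r₁ (trans (sym eq) e₁)
        ... | inj₂ e₂ = v≢r₂ (trans (sym eq) e₂)

      -- The two representatives r₁, r₂ of s are replaced by the single one m of t.
      ∏ᶜ-merge : ∀ F G → (∀ v → merged v ≡ false → F v ≡ G v) → F m ≡ G r₁ * G r₂ → ∏ᶜ t F ≡ ∏ᶜ s G
      ∏ᶜ-merge F G F≗G Fm = begin
        prodFin nV Ft                      ≡⟨ prodFin-pick nV Ft m ⟩
        Ft m * prodFin nV Ft′              ≡⟨ cong₂ _*_ Ft-m (prodFin-cong nV rest) ⟩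
        (G r₁ * G r₂) * prodFin nV Gs″     ≡⟨ *-assoc (G r₁) (G r₂) _ ⟩
        G r₁ * (G r₂ * prodFin nV Gs″)     ≡⟨ cong₂ (λ x y → x * (y * prodFin nV Gs″)) (sym Gs-r₁) (sym Gs′-r₂) ⟩
        Gs r₁ * (Gs′ r₂ * prodFin nV Gs″)  ≡⟨ cong (Gs r₁ *_) (prodFin-pick nV Gs′ r₂) ⟨
        Gs r₁ * prodFin nV Gs′             ≡⟨ prodFin-pick nV Gs r₁ ⟨
        prodFin nV Gs                      ∎
        where
        open ≡-Reasoning
        Ft Ft′ Gs Gs′ Gs″ : Fin nV → ℚ
        Ft  = atReps t F
        Ft′ = updateAt Ft m (const 1ℚ)
        Gs  = atReps s G
        Gs′ = updateAt Gs r₁ (const 1ℚ)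
        Gs″ = updateAt Gs′ r₂ (const 1ℚ)

        Ft-m : Ft m ≡ G r₁ * G r₂
        Ft-m rewrite isRep-rep t a = Fm
        Gs-r₁ : Gs r₁ ≡ G r₁
        Gs-r₁ rewrite isRep-rep s a = refl
        Gs′-r₂ : Gs′ r₂ ≡ G r₂
        Gs′-r₂ = trans (updateAt-minimal r₂ r₁ Gs (r₁≢r₂ ∘ sym)) (cong (λ r → if r then G r₂ else 1ℚ) (isRep-rep s b))

        outside : ∀ v → merged v ≡ false → Ft′ v ≡ Gs″ v
        outside v mv = begin
          Ft′ v   ≡⟨ updateAt-minimal v m Ft (apart v m mv merged-m) ⟩
          Ft v    ≡⟨ cong₂ (λ r x → if r then x else 1ℚ) (isRep-outside v mv) (F≗G v mv) ⟩
          Gs v    ≡⟨ updateAt-minimal v r₁ Gs (apart v r₁ mv merged-r₁) ⟨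
          Gs′ v   ≡⟨ updateAt-minimal v r₂ Gs′ (apart v r₂ mv merged-r₂) ⟨
          Gs″ v   ∎

        rest : ∀ v → Ft′ v ≡ Gs″ v
        rest v with merged v in mv
        ... | false = outside v mv
        ... | true  = trans (one-at-t F v mv) (sym (one-at-s G v mv))

  -- The change of basis ℱ

  W W½ : State Γ → Labelling Γ → Labelling Γ → ℚ
  W  s x y = ∏ᶜ s (λ v → χ (lookup x v) (lookup y v))
  W½ s x y = ∏ᶜ s (λ v → ½ * χ (lookup x v) (lookup y v))

  -- χ is multiplicative, so merging components along e does not change the weight.
  W-Tlab : ∀ t e (te : lookup t e ≡ true) ℓ κ → isValid (t [ e ]≔ false) ℓ ≡ true → isValid t κ ≡ true →
    W t (Tlab Γ (t [ e ]≔ false) e ℓ) κ ≡ W (t [ e ]≔ false) ℓ κ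
  W-Tlab t e te ℓ κ vℓ vκ with sameComp Γ (t [ e ]≔ false) (src Γ e) (tgt Γ e) in ab
  ... | true  = Insertion.∏ᶜ-insert-inside t e te ab _
  ... | false = ∏ᶜ-merge F G outside at-m
    where
    open Insertion t e te
    open Merging ab
    κ′ ℓ′ : Fin nV → Label
    κ′ = lookup κ
    ℓ′ = lookup ℓ
    F G : Fin nV → ℚ
    F v = χ (lookup (merged-label ℓ) v) (κ′ v)
    G v = χ (ℓ′ v) (κ′ v)

    outside : ∀ v → merged v ≡ false → F v ≡ G v
    outside v mv rewrite lookup-merged-label ℓ v | mv = refl

    κ-merged : ∀ v → merged v ≡ true → κ′ v ≡ κ′ m
    κ-merged v mv = trans (sym (isValid⇒Valid t κ vκ a v (merged⇒sameComp v mv)))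
                          (isValid⇒Valid t κ vκ a m (rep-sameComp t a))

    at-m : F m ≡ G r₁ * G r₂
    at-m rewrite lookup-merged-label ℓ m | merged-m
               | κ-merged r₁ merged-r₁ | κ-merged r₂ merged-r₂
               | sym (isValid⇒rep s ℓ vℓ a) | sym (isValid⇒rep s ℓ vℓ b) = χ-mulL (ℓ′ a) (ℓ′ b) (κ′ m)

  labellings : List (Labelling Γ)
  labellings = allLabellings nV

  -- Valid labellings are labellings of the components, read off at the representatives.
  sumValid-∏ᶜ : ∀ s (h : Fin nV → Label → ℚ) →
    sumList labellings (λ ℓ → 𝟙 (isValid s ℓ) * ∏ᶜ s (λ v → h v (lookup ℓ v))) ≡ ∏ᶜ s (λ v → sumLabel (h v))
  sumValid-∏ᶜ s h = trans (sumList-cong labellings (λ ℓ → trans (𝟙-allFin-* (P ℓ) _) (prodFin-cong nV (at ℓ))))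
    (sumLabellings-∏-forward nV (rep s) (rep-≥ s) f _ fixed moved)
    where
    P : Labelling Γ → Fin nV → Bool
    P ℓ v = eqL (lookup ℓ v) (lookup ℓ (rep s v))

    f : Fin nV → Label → Label → ℚ
    f v x y = if isRep s v then h v x else 𝟙 (eqL x y)

    at : ∀ ℓ v → 𝟙 (eqL (lookup ℓ v) (lookup ℓ (rep s v))) * (if isRep s v then h v (lookup ℓ v) else 1ℚ)
               ≡ f v (lookup ℓ v) (lookup ℓ (rep s v))
    at ℓ v with isRep s v in r
    ... | true  rewrite isRep⇒ s v r | eqL-refl (lookup ℓ v) = *-identityˡ _
    ... | false = *-identityʳ _

    fixed : ∀ v → rep s v ≡ v → sumLabel (λ x → f v x x) ≡ (if isRep s v then sumLabel (h v) else 1ℚ)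
    fixed v fx rewrite dec-true (rep s v ≟ v) fx = refl

    moved : ∀ v → rep s v ≢ v → ∀ y → sumLabel (λ x → f v x y) ≡ (if isRep s v then sumLabel (h v) else 1ℚ)
    moved v mv y rewrite ¬isRep s v mv with y
    ... | one = refl
    ... | ex  = refl

  ∏ᶜ-eqL : ∀ s x z → isValid s x ≡ true → isValid s z ≡ true →
    ∏ᶜ s (λ v → 𝟙 (eqL (lookup x v) (lookup z v))) ≡ 𝟙 (eqVecL x z)
  ∏ᶜ-eqL s x z vx vz with eqVecL x z in xz
  ... | true  rewrite eqVecL⇒≡ x z xz = ∏ᶜ-one s (λ v _ → cong 𝟙 (eqL-refl (lookup z v)))
  ... | false = let v , xz-v = eqVecL-false x z xz in
    ∏ᶜ-zero s _ v (cong 𝟙 (subst₂ (λ p q → eqL p q ≡ false) (isValid⇒rep s x vx v) (isValid⇒rep s z vz v) xz-v))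

  ∏ᶜ-orthogonal : ∀ s x z (h : Label → Label → Label → ℚ) → (∀ a b → sumLabel (λ y → h a y b) ≡ 𝟙 (eqL a b)) →
    isValid s x ≡ true → isValid s z ≡ true →
    sumList labellings (λ y → 𝟙 (isValid s y) * ∏ᶜ s (λ v → h (lookup x v) (lookup y v) (lookup z v)))
      ≡ 𝟙 (eqVecL x z)
  ∏ᶜ-orthogonal s x z h orth vx vz = begin
    sumList labellings (λ y → 𝟙 (isValid s y) * ∏ᶜ s (λ v → h (lookup x v) (lookup y v) (lookup z v)))
      ≡⟨ sumValid-∏ᶜ s (λ v y → h (lookup x v) y (lookup z v)) ⟩
    ∏ᶜ s (λ v → sumLabel (λ y → h (lookup x v) y (lookup z v)))
      ≡⟨ ∏ᶜ-cong s (λ v _ → orth (lookup x v) (lookup z v)) ⟩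
    ∏ᶜ s (λ v → 𝟙 (eqL (lookup x v) (lookup z v)))
      ≡⟨ ∏ᶜ-eqL s x z vx vz ⟩
    𝟙 (eqVecL x z) ∎
    where open ≡-Reasoning

  Supported : Cochain Γ → Set
  Supported c = ∀ s ℓ → isValid s ℓ ≡ false → c s ℓ ≡ 0ℚ

  Kernel : Set
  Kernel = State Γ → Labelling Γ → Labelling Γ → ℚ

  transform : Kernel → Cochain Γ → Cochain Γ
  transform K c s y = 𝟙 (isValid s y) * sumList labellings (λ x → c s x * K s x y)

  transform-supported : ∀ K c → Supported (transform K c)
  transform-supported K c s y vy rewrite vy = *-zeroˡ (sumList labellings (λ x → c s x * K s x y))

  transform-cong : ∀ K {c c′} s y → (∀ x → c s x ≡ c′ s x) → transform K c s y ≡ transform K c′ s y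
  transform-cong K s y c≗c′ = cong (𝟙 (isValid s y) *_) (sumList-cong labellings (λ x → cong (_* K s x y) (c≗c′ x)))

  transform-zero : ∀ K c s y → (∀ x → c s x ≡ 0ℚ) → transform K c s y ≡ 0ℚ
  transform-zero K c s y c≡0 = trans (cong (𝟙 (isValid s y) *_) (sumList-zero labellings (λ x →
    trans (cong (_* K s x y) (c≡0 x)) (*-zeroˡ (K s x y))))) (*-zeroʳ (𝟙 (isValid s y)))

  transform-lin : ∀ K p X q Y s y → transform K (lin Γ p X q Y) s y ≡ p * transform K X s y + q * transform K Y s y
  transform-lin K p X q Y s y = begin
    𝟙v * sumList labellings (λ x → (p * X s x + q * Y s x) * K s x y)
      ≡⟨ cong (𝟙v *_) (sumList-cong labellings (λ x → distrib p (X s x) q (Y s x) (K s x y))) ⟩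
    𝟙v * sumList labellings (λ x → p * (X s x * K s x y) + q * (Y s x * K s x y))
      ≡⟨ cong (𝟙v *_) (sumList-+ labellings _ _) ⟩
    𝟙v * (sumList labellings (λ x → p * (X s x * K s x y)) + sumList labellings (λ x → q * (Y s x * K s x y)))
      ≡⟨ cong (𝟙v *_) (cong₂ _+_ (sumList-*ˡ labellings p _) (sumList-*ˡ labellings q _)) ⟩
    𝟙v * (p * ΣX + q * ΣY)
      ≡⟨ solve 5 (λ i p x q y → i :* (p :* x :+ q :* y) := p :* (i :* x) :+ q :* (i :* y)) refl 𝟙v p ΣX q ΣY ⟩
    p * (𝟙v * ΣX) + q * (𝟙v * ΣY) ∎
    where
    open ≡-Reasoning
    𝟙v = 𝟙 (isValid s y)
    ΣX = sumList labellings (λ x → X s x * K s x y)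
    ΣY = sumList labellings (λ x → Y s x * K s x y)
    distrib : ∀ p x q y k → (p * x + q * y) * k ≡ p * (x * k) + q * (y * k)
    distrib = solve 5 (λ p x q y k → (p :* x :+ q :* y) :* k := p :* (x :* k) :+ q :* (y :* k)) refl

  Orthogonal : Kernel → Kernel → Set
  Orthogonal K K′ = ∀ s x z → isValid s x ≡ true → isValid s z ≡ true →
    sumList labellings (λ y → 𝟙 (isValid s y) * (K s x y * K′ s y z)) ≡ 𝟙 (eqVecL x z)

  transform-cancel : ∀ K K′ → Orthogonal K K′ → ∀ c → Supported c → ∀ s z → transform K′ (transform K c) s z ≡ c s z
  transform-cancel K K′ orth c c-supp s z = begin
    𝟙 (isValid s z) * sumList labellings (λ y → (𝟙 (isValid s y) * sumList labellings (λ x → c s x * K s x y)) * K′ s y z)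
      ≡⟨ cong (𝟙 (isValid s z) *_) (sumList-interchange labellings labellings (𝟙 ∘ isValid s) (λ y → K′ s y z) (c s) (K s)) ⟩
    𝟙 (isValid s z) * sumList labellings (λ x → c s x * O x)
      ≡⟨ collapse (isValid s z) refl ⟩
    c s z ∎
    where
    open ≡-Reasoning
    O : Labelling Γ → ℚ
    O x = sumList labellings (λ y → 𝟙 (isValid s y) * (K s x y * K′ s y z))

    at : isValid s z ≡ true → ∀ x → c s x * O x ≡ (if eqVecL z x then c s x else 0ℚ)
    at vz x with isValid s x in vx
    ... | true  rewrite orth s x z vx vz | eqVecL-comm x z with eqVecL z x
    ...   | true  = *-identityʳ (c s x)
    ...   | false = *-zeroʳ (c s x)
    at vz x | false rewrite c-supp s x vx with eqVecL z x
    ...   | true  = *-zeroˡ (O x)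
    ...   | false = *-zeroˡ (O x)

    collapse : ∀ b → isValid s z ≡ b → 𝟙 b * sumList labellings (λ x → c s x * O x) ≡ c s z
    collapse false vz = trans (*-zeroˡ (sumList labellings (λ x → c s x * O x))) (sym (c-supp s z vz))
    collapse true  vz = trans (*-identityˡ _)
      (trans (sumList-cong labellings (at vz)) (sumLabellings-δ nV z (c s)))

  ℱ ℱ⁻¹ : Cochain Γ → Cochain Γ
  ℱ   = transform W
  ℱ⁻¹ = transform W½

  ℱ⁻¹-ℱ : ∀ c → Supported c → ∀ s ℓ → ℱ⁻¹ (ℱ c) s ℓ ≡ c s ℓ
  ℱ⁻¹-ℱ = transform-cancel W W½ λ s x z vx vz →
    trans (sumList-cong labellings (λ y → cong (𝟙 (isValid s y) *_) (∏ᶜ-* s _ _)))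
          (∏ᶜ-orthogonal s x z (λ a y b → χ a y * (½ * χ y b)) χ-orthogonal vx vz)

  ℱ-ℱ⁻¹ : ∀ g → Supported g → ∀ s κ → ℱ (ℱ⁻¹ g) s κ ≡ g s κ
  ℱ-ℱ⁻¹ = transform-cancel W½ W λ s x z vx vz →
    trans (sumList-cong labellings (λ y → cong (𝟙 (isValid s y) *_) (∏ᶜ-* s _ _)))
          (∏ᶜ-orthogonal s x z (λ a y b → ½ * χ a y * χ y b) χ-orthogonal′ vx vz)

  ℱ-injective : ∀ c c′ → Supported c → Supported c′ →
    (∀ s κ → isValid s κ ≡ true → ℱ c s κ ≡ ℱ c′ s κ) → _≗ᶜ_ Γ c c′
  ℱ-injective c c′ c-supp c′-supp ℱc≗ℱc′ s ℓ = begin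
    c s ℓ           ≡⟨ ℱ⁻¹-ℱ c c-supp s ℓ ⟨
    ℱ⁻¹ (ℱ c) s ℓ   ≡⟨ transform-cong W½ {ℱ c} {ℱ c′} s ℓ at ⟩
    ℱ⁻¹ (ℱ c′) s ℓ  ≡⟨ ℱ⁻¹-ℱ c′ c′-supp s ℓ ⟩
    c′ s ℓ          ∎
    where
    open ≡-Reasoning
    at : ∀ κ → ℱ c s κ ≡ ℱ c′ s κ
    at κ with true-or-false (isValid s κ)
    ... | inj₁ vκ = ℱc≗ℱc′ s κ vκ
    ... | inj₂ vκ = trans (transform-supported W c s κ vκ) (sym (transform-supported W c′ s κ vκ))

  -- The differential after the change of basis

  σ : State Γ → Fin nE → ℚ
  σ s e = signℚ (nse Γ s e)

  D̂ : Cochain Γ → Cochain Γ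
  D̂ f t κ = sumFin nE λ e → if lookup t e then σ (t [ e ]≔ false) e * f (t [ e ]≔ false) κ else 0ℚ

  D-term : Cochain Γ → State Γ → Fin nE → Labelling Γ → ℚ
  D-term c t e μ = sumList labellings λ ℓ →
    if eqVecL (Tlab Γ (t [ e ]≔ false) e ℓ) μ then σ (t [ e ]≔ false) e * c (t [ e ]≔ false) ℓ else 0ℚ

  D-term-supported : ∀ c → Supported c → ∀ t e → lookup t e ≡ true → ∀ μ → isValid t μ ≡ false → D-term c t e μ ≡ 0ℚ
  D-term-supported c c-supp t e te μ vμ = sumList-zero labellings at-labelling
    where
    s = t [ e ]≔ false
    at-labelling : ∀ ℓ → (if eqVecL (Tlab Γ s e ℓ) μ then σ s e * c s ℓ else 0ℚ) ≡ 0ℚ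
    at-labelling ℓ with true-or-false (isValid s ℓ) | eqVecL (Tlab Γ s e ℓ) μ in eq
    ... | _       | false = refl
    ... | inj₂ vℓ | true  rewrite c-supp s ℓ vℓ = *-zeroʳ (σ s e)
    ... | inj₁ vℓ | true  = ⊥-elim (true≢false (trans (sym (Insertion.Tlab-valid t e te ℓ vℓ))
                              (trans (cong (isValid t) (eqVecL⇒≡ (Tlab Γ s e ℓ) μ eq)) vμ)))

  D-supported : ∀ c → Supported c → Supported (D Γ c)
  D-supported c c-supp t μ vμ = sumFin-zero nE at-edge
    where
    at-edge : ∀ e → (if lookup t e then D-term c t e μ else 0ℚ) ≡ 0ℚ
    at-edge e with lookup t e in te
    ... | false = refl
    ... | true  = D-term-supported c c-supp t e te μ vμ

  ℱ-D-term : ∀ c → Supported c → ∀ t e → lookup t e ≡ true → ∀ κ → isValid t κ ≡ true →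
    sumList labellings (λ μ → D-term c t e μ * W t μ κ) ≡ σ (t [ e ]≔ false) e * ℱ c (t [ e ]≔ false) κ
  ℱ-D-term c c-supp t e te κ vκ = begin
    sumList labellings (λ μ → sumList labellings (B μ) * W t μ κ)
      ≡⟨ sumList-cong labellings (λ μ → sumList-*ʳ labellings (W t μ κ) (B μ)) ⟨
    sumList labellings (λ μ → sumList labellings (λ ℓ → B μ ℓ * W t μ κ))
      ≡⟨ sumList-comm labellings labellings (λ μ ℓ → B μ ℓ * W t μ κ) ⟩
    sumList labellings (λ ℓ → sumList labellings (λ μ → B μ ℓ * W t μ κ))
      ≡⟨ sumList-cong labellings at-labelling ⟩
    sumList labellings (λ ℓ → σ s e * (c s ℓ * W s ℓ κ))
      ≡⟨ sumList-*ˡ labellings (σ s e) (λ ℓ → c s ℓ * W s ℓ κ) ⟩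
    σ s e * sumList labellings (λ ℓ → c s ℓ * W s ℓ κ)
      ≡⟨ cong (σ s e *_) (*-identityˡ _) ⟨
    σ s e * (1ℚ * sumList labellings (λ ℓ → c s ℓ * W s ℓ κ))
      ≡⟨ cong (λ b → σ s e * (𝟙 b * sumList labellings (λ ℓ → c s ℓ * W s ℓ κ)))
              (isValid-mono κ (Insertion.s⊆t t e te) vκ) ⟨
    σ s e * ℱ c s κ ∎
    where
    open ≡-Reasoning
    s = t [ e ]≔ false
    B : Labelling Γ → Labelling Γ → ℚ
    B μ ℓ = if eqVecL (Tlab Γ s e ℓ) μ then σ s e * c s ℓ else 0ℚ

    weight : ∀ ℓ → c s ℓ * W t (Tlab Γ s e ℓ) κ ≡ c s ℓ * W s ℓ κ
    weight ℓ with true-or-false (isValid s ℓ)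
    ... | inj₁ vℓ = cong (c s ℓ *_) (W-Tlab t e te ℓ κ vℓ vκ)
    ... | inj₂ vℓ rewrite c-supp s ℓ vℓ = trans (*-zeroˡ (W t (Tlab Γ s e ℓ) κ)) (sym (*-zeroˡ (W s ℓ κ)))

    at-labelling : ∀ ℓ → sumList labellings (λ μ → B μ ℓ * W t μ κ) ≡ σ s e * (c s ℓ * W s ℓ κ)
    at-labelling ℓ = begin
      sumList labellings (λ μ → B μ ℓ * W t μ κ)
        ≡⟨ sumList-cong labellings (λ μ → if-then-0-* (eqVecL (Tlab Γ s e ℓ) μ) (σ s e * c s ℓ) (W t μ κ)) ⟩
      sumList labellings (λ μ → if eqVecL (Tlab Γ s e ℓ) μ then σ s e * c s ℓ * W t μ κ else 0ℚ)
        ≡⟨ sumLabellings-δ nV (Tlab Γ s e ℓ) (λ μ → σ s e * c s ℓ * W t μ κ) ⟩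
      σ s e * c s ℓ * W t (Tlab Γ s e ℓ) κ
        ≡⟨ *-assoc (σ s e) (c s ℓ) _ ⟩
      σ s e * (c s ℓ * W t (Tlab Γ s e ℓ) κ)
        ≡⟨ cong (σ s e *_) (weight ℓ) ⟩
      σ s e * (c s ℓ * W s ℓ κ) ∎

  ℱ-D : ∀ c → Supported c → ∀ t κ → isValid t κ ≡ true → ℱ (D Γ c) t κ ≡ D̂ (ℱ c) t κ
  ℱ-D c c-supp t κ vκ rewrite vκ = begin
    1ℚ * sumList labellings (λ μ → D Γ c t μ * W t μ κ)
      ≡⟨ *-identityˡ _ ⟩
    sumList labellings (λ μ → sumFin nE (λ e → A e μ) * W t μ κ)
      ≡⟨ sumList-cong labellings (λ μ → sumFin-*ʳ nE (W t μ κ) (λ e → A e μ)) ⟨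
    sumList labellings (λ μ → sumFin nE (λ e → A e μ * W t μ κ))
      ≡⟨ sumFin-sumList-comm nE labellings (λ e μ → A e μ * W t μ κ) ⟨
    sumFin nE (λ e → sumList labellings (λ μ → A e μ * W t μ κ))
      ≡⟨ sumFin-cong nE at-edge ⟩
    D̂ (ℱ c) t κ ∎
    where
    open ≡-Reasoning
    A : Fin nE → Labelling Γ → ℚ
    A e μ = if lookup t e then D-term c t e μ else 0ℚ

    at-edge : ∀ e → sumList labellings (λ μ → A e μ * W t μ κ)
                  ≡ (if lookup t e then σ (t [ e ]≔ false) e * ℱ c (t [ e ]≔ false) κ else 0ℚ)
    at-edge e with lookup t e in te
    ... | false = sumList-zero labellings (λ μ → *-zeroˡ (W t μ κ))
    ... | true  = ℱ-D-term c c-supp t e te κ vκ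

  nse-insert : ∀ u x y → lookup u x ≡ false → nse Γ (u [ x ]≔ true) y ≡ 𝟙ℕ (does (x <? y)) ℕ.+ nse Γ u y
  nse-insert u x y ux = begin
    countFin nE P′                                                 ≡⟨ countFin-pick nE P′ x ⟩
    𝟙ℕ (P′ x) ℕ.+ countFin nE (updateAt P′ x (const false))        ≡⟨ cong₂ ℕ._+_ P′x (countFin-cong nE same) ⟩
    𝟙ℕ (does (x <? y)) ℕ.+ countFin nE (updateAt P x (const false)) ≡⟨ cong (𝟙ℕ (does (x <? y)) ℕ.+_) drop-x ⟨
    𝟙ℕ (does (x <? y)) ℕ.+ countFin nE P                          ∎
    where
    open ≡-Reasoning
    P P′ : Fin nE → Bool
    P  e = lookup u e ∧ does (e <? y)
    P′ e = lookup (u [ x ]≔ true) e ∧ does (e <? y)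
    drop-x : countFin nE P ≡ countFin nE (updateAt P x (const false))
    drop-x = trans (countFin-pick nE P x)
      (cong (λ b → 𝟙ℕ (b ∧ does (x <? y)) ℕ.+ countFin nE (updateAt P x (const false))) ux)
    P′x : 𝟙ℕ (P′ x) ≡ 𝟙ℕ (does (x <? y))
    P′x rewrite Vecₚ.lookup∘update x u true = refl
    same : ∀ e → updateAt P′ x (const false) e ≡ updateAt P x (const false) e
    same e with e ≟ x
    ... | yes refl = trans (updateAt-updates x P′) (sym (updateAt-updates x P))
    ... | no e≢x   = trans (updateAt-minimal e x P′ e≢x)
        (trans (cong (_∧ does (e <? y)) (Vecₚ.lookup∘update′ e≢x u true)) (sym (updateAt-minimal e x P e≢x)))

  -- The sign rule behind d² = 0.
  σ-anticommute : ∀ u x y → x ≢ y → lookup u x ≡ false → lookup u y ≡ false →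
    σ (u [ x ]≔ true) y * σ (u [ y ]≔ true) x ≡ - (σ u y * σ u x)
  σ-anticommute u x y x≢y ux uy = begin
    σ (u [ x ]≔ true) y * σ (u [ y ]≔ true) x
      ≡⟨ cong₂ _*_ (cong signℚ (nse-insert u x y ux)) (cong signℚ (nse-insert u y x uy)) ⟩
    signℚ (𝟙ℕ (does (x <? y)) ℕ.+ nse Γ u y) * signℚ (𝟙ℕ (does (y <? x)) ℕ.+ nse Γ u x)
      ≡⟨ cong₂ _*_ (signℚ-+ (𝟙ℕ (does (x <? y))) (nse Γ u y)) (signℚ-+ (𝟙ℕ (does (y <? x))) (nse Γ u x)) ⟩
    (sxy * σ u y) * (syx * σ u x)
      ≡⟨ solve 4 (λ a b c d → (a :* b) :* (c :* d) := (a :* c) :* (b :* d)) refl sxy (σ u y) syx (σ u x) ⟩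
    (sxy * syx) * (σ u y * σ u x)
      ≡⟨ cong (_* (σ u y * σ u x)) (signℚ-<-swap x y x≢y) ⟩
    - 1ℚ * (σ u y * σ u x)
      ≡⟨ solve 1 (λ a → (:- con 1ℚ) :* a := :- a) refl (σ u y * σ u x) ⟩
    - (σ u y * σ u x) ∎
    where
    open ≡-Reasoning
    sxy = signℚ (𝟙ℕ (does (x <? y)))
    syx = signℚ (𝟙ℕ (does (y <? x)))

  cone : Fin nE → Cochain Γ → Cochain Γ
  cone e₀ f s κ = if lookup s e₀ then 0ℚ else σ s e₀ * f (s [ e₀ ]≔ true) κ

  D̂-cone-∈ : ∀ f κ e₀ t → lookup t e₀ ≡ true → D̂ (cone e₀ f) t κ ≡ f t κ
  D̂-cone-∈ f κ e₀ t te₀ = begin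
    sumFin nE H                                      ≡⟨ sumFin-pick nE H e₀ ⟩
    H e₀ + sumFin nE (updateAt H e₀ (const 0ℚ))       ≡⟨ cong₂ _+_ H-e₀ (sumFin-zero nE rest) ⟩
    f t κ + 0ℚ                                       ≡⟨ +-identityʳ (f t κ) ⟩
    f t κ                                            ∎
    where
    open ≡-Reasoning
    H : Fin nE → ℚ
    H e = if lookup t e then σ (t [ e ]≔ false) e * cone e₀ f (t [ e ]≔ false) κ else 0ℚ

    H-e₀ : H e₀ ≡ f t κ
    H-e₀ rewrite te₀ | Vecₚ.lookup∘update e₀ t false | update-restore t e₀ {b′ = false} te₀ =
      trans (sym (*-assoc (σ (t [ e₀ ]≔ false) e₀) (σ (t [ e₀ ]≔ false) e₀) (f t κ)))
            (trans (cong (_* f t κ) (signℚ-sq (nse Γ (t [ e₀ ]≔ false) e₀))) (*-identityˡ (f t κ)))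

    -- Removing any other edge keeps e₀, where the cone vanishes.
    H-other : ∀ e → e ≢ e₀ → H e ≡ 0ℚ
    H-other e e≢e₀ with lookup t e
    ... | false = refl
    ... | true rewrite Vecₚ.lookup∘update′ (e≢e₀ ∘ sym) t false | te₀ = *-zeroʳ (σ (t [ e ]≔ false) e)

    rest : ∀ e → updateAt H e₀ (const 0ℚ) e ≡ 0ℚ
    rest e with e ≟ e₀
    ... | yes refl = updateAt-updates e₀ H
    ... | no e≢e₀  = trans (updateAt-minimal e e₀ H e≢e₀) (H-other e e≢e₀)

  cone-remove : ∀ f κ e₀ t e → lookup t e₀ ≡ false → e ≢ e₀ → lookup t e ≡ true →
    σ (t [ e ]≔ false) e * cone e₀ f (t [ e ]≔ false) κ
      ≡ - σ t e₀ * (σ ((t [ e₀ ]≔ true) [ e ]≔ false) e * f ((t [ e₀ ]≔ true) [ e ]≔ false) κ)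
  cone-remove f κ e₀ t e te₀ e≢e₀ te
    rewrite Vecₚ.lookup∘update′ (e≢e₀ ∘ sym) t false | te₀
          | Vecₚ.[]≔-commutes {x = true} {y = false} t e₀ e (e≢e₀ ∘ sym) = reorder (σ-anticommute u e e₀ e≢e₀ ue ue₀)
    where
    open ≡-Reasoning
    u = t [ e ]≔ false
    ue : lookup u e ≡ false
    ue = Vecₚ.lookup∘update e t false
    ue₀ : lookup u e₀ ≡ false
    ue₀ = trans (Vecₚ.lookup∘update′ (e≢e₀ ∘ sym) t false) te₀
    F = f (u [ e₀ ]≔ true) κ
    reorder : σ (u [ e ]≔ true) e₀ * σ (u [ e₀ ]≔ true) e ≡ - (σ u e₀ * σ u e) →
      σ u e * (σ u e₀ * F) ≡ - σ t e₀ * (σ (u [ e₀ ]≔ true) e * F)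
    reorder anti rewrite update-restore t e {b′ = false} te = begin
      σ u e * (σ u e₀ * F)                   ≡⟨ solve 3 (λ a b x → a :* (b :* x) := :- (:- (b :* a)) :* x) refl (σ u e) (σ u e₀) F ⟩
      - (- (σ u e₀ * σ u e)) * F             ≡⟨ cong (λ z → - z * F) anti ⟨
      - (σ t e₀ * σ (u [ e₀ ]≔ true) e) * F  ≡⟨ solve 3 (λ a b x → :- (a :* b) :* x := :- a :* (b :* x)) refl (σ t e₀) _ F ⟩
      - σ t e₀ * (σ (u [ e₀ ]≔ true) e * F)  ∎

  D̂-cone-∉ : ∀ f κ e₀ t → lookup t e₀ ≡ false → D̂ f (t [ e₀ ]≔ true) κ ≡ 0ℚ → D̂ (cone e₀ f) t κ ≡ f t κ
  D̂-cone-∉ f κ e₀ t te₀ cocycle = begin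
    sumFin nE H                          ≡⟨ sumFin-cong nE H≗ ⟩
    sumFin nE (λ e → - σ t e₀ * K′ e)    ≡⟨ sumFin-*ˡ nE (- σ t e₀) K′ ⟩
    - σ t e₀ * sumFin nE K′              ≡⟨ square-one-solve (σ t e₀) (f t κ) (sumFin nE K′) (signℚ-sq (nse Γ t e₀)) split ⟩
    f t κ                                ∎
    where
    open ≡-Reasoning
    t′ : State Γ
    t′ = t [ e₀ ]≔ true
    H K K′ : Fin nE → ℚ
    H e = if lookup t e then σ (t [ e ]≔ false) e * cone e₀ f (t [ e ]≔ false) κ else 0ℚ
    K e = if lookup t′ e then σ (t′ [ e ]≔ false) e * f (t′ [ e ]≔ false) κ else 0ℚ
    K′  = updateAt K e₀ (const 0ℚ)

    split : σ t e₀ * f t κ + sumFin nE K′ ≡ 0ℚ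
    split = trans (cong (_+ sumFin nE K′) (sym K-e₀)) (trans (sym (sumFin-pick nE K e₀)) cocycle)
      where
      K-e₀ : K e₀ ≡ σ t e₀ * f t κ
      K-e₀ rewrite Vecₚ.lookup∘update e₀ t true | update-restore t e₀ {b′ = true} te₀ = refl

    at-other : ∀ e → e ≢ e₀ → ∀ b → lookup t e ≡ b →
      (if b then σ (t [ e ]≔ false) e * cone e₀ f (t [ e ]≔ false) κ else 0ℚ)
        ≡ - σ t e₀ * (if b then σ (t′ [ e ]≔ false) e * f (t′ [ e ]≔ false) κ else 0ℚ)
    at-other e e≢e₀ false te = sym (*-zeroʳ (- σ t e₀))
    at-other e e≢e₀ true  te = cone-remove f κ e₀ t e te₀ e≢e₀ te

    H≗ : ∀ e → H e ≡ - σ t e₀ * K′ e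
    H≗ e with e ≟ e₀
    ... | yes refl = trans H-e₀ (sym (trans (cong (- σ t e₀ *_) (updateAt-updates e₀ K)) (*-zeroʳ (- σ t e₀))))
      where
      H-e₀ : H e₀ ≡ 0ℚ
      H-e₀ rewrite te₀ = refl
    ... | no e≢e₀ = trans (at-other e e≢e₀ (lookup t e) refl)
      (cong (- σ t e₀ *_) (sym (trans (updateAt-minimal e e₀ K e≢e₀) K-e)))
      where
      K-e : K e ≡ (if lookup t e then σ (t′ [ e ]≔ false) e * f (t′ [ e ]≔ false) κ else 0ℚ)
      K-e rewrite Vecₚ.lookup∘update′ e≢e₀ t true = refl

  D̂-cone : ∀ f κ e₀ → Monochromatic κ e₀ ≡ true → (∀ t → isValid t κ ≡ true → D̂ f t κ ≡ 0ℚ) →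
    ∀ t → isValid t κ ≡ true → D̂ (cone e₀ f) t κ ≡ f t κ
  D̂-cone f κ e₀ mono cocycle t vt with true-or-false (lookup t e₀)
  ... | inj₁ te₀ = D̂-cone-∈ f κ e₀ t te₀
  ... | inj₂ te₀ = D̂-cone-∉ f κ e₀ t te₀ (cocycle (t [ e₀ ]≔ true) (isValid-edges _ κ mono′))
    where
    mono′ : ∀ e → lookup (t [ e₀ ]≔ true) e ≡ true → Monochromatic κ e ≡ true
    mono′ e h with e ≟ e₀
    ... | yes refl = mono
    ... | no e≢e₀  = isValid⇒monochromatic t κ vt e (trans (sym (Vecₚ.lookup∘update′ e≢e₀ t true)) h)

  D̂-cong : ∀ F F′ t κ → (∀ e → lookup t e ≡ true → F (t [ e ]≔ false) κ ≡ F′ (t [ e ]≔ false) κ) →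
    D̂ F t κ ≡ D̂ F′ t κ
  D̂-cong F F′ t κ F≗F′ = sumFin-cong nE at
    where
    at : ∀ e → (if lookup t e then σ (t [ e ]≔ false) e * F (t [ e ]≔ false) κ else 0ℚ)
             ≡ (if lookup t e then σ (t [ e ]≔ false) e * F′ (t [ e ]≔ false) κ else 0ℚ)
    at e with lookup t e in te
    ... | true  = cong (σ (t [ e ]≔ false) e *_) (F≗F′ e te)
    ... | false = refl

  D̂-zero : ∀ F t κ → (∀ e → lookup t e ≡ true → F (t [ e ]≔ false) κ ≡ 0ℚ) → D̂ F t κ ≡ 0ℚ
  D̂-zero F t κ F≡0 = sumFin-zero nE at
    where
    at : ∀ e → (if lookup t e then σ (t [ e ]≔ false) e * F (t [ e ]≔ false) κ else 0ℚ) ≡ 0ℚ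
    at e with lookup t e in te
    ... | true  = trans (cong (σ (t [ e ]≔ false) e *_) (F≡0 e te)) (*-zeroʳ (σ (t [ e ]≔ false) e))
    ... | false = refl

  D̂-empty : ∀ F t κ → NoEdges t → D̂ F t κ ≡ 0ℚ
  D̂-empty F t κ empty = D̂-zero F t κ (λ e te → ⊥-elim (true≢false (trans (sym te) (empty e))))

  monochromatic? : ∀ κ → Dec (∃ λ e → Monochromatic κ e ≡ true)
  monochromatic? κ = Finₚ.any? (λ e → Monochromatic κ e Data.Bool.≟ true)

  coneAt : ∀ {κ} → Dec (∃ λ e → Monochromatic κ e ≡ true) → Cochain Γ → State Γ → ℚ
  coneAt {κ} (yes (e₀ , _)) f s = cone e₀ f s κ
  coneAt     (no _)         f s = 0ℚ

  -- The null-homotopy of D̂, colour by colour: the cone over the first monochromatic edge.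
  contraction : Cochain Γ → Cochain Γ
  contraction f s κ = 𝟙 (isValid s κ) * coneAt {κ} (monochromatic? κ) f s

  contraction-supported : ∀ f → Supported (contraction f)
  contraction-supported f s κ vs rewrite vs = *-zeroˡ (coneAt {κ} (monochromatic? κ) f s)

  D̂-contraction : ∀ f κ → (∀ t → isValid t κ ≡ true → D̂ f t κ ≡ 0ℚ) →
    (∀ t → NoEdges t → f t κ ≡ 0ℚ) →
    ∀ t → isValid t κ ≡ true → D̂ (contraction f) t κ ≡ f t κ
  D̂-contraction f κ cocycle f-empty t vt =
    trans (D̂-cong (contraction f) (λ s _ → coneAt {κ} (monochromatic? κ) f s) t κ valid-below)
    (by-choice (monochromatic? κ))
    where
    valid-below : ∀ e → lookup t e ≡ true → contraction f (t [ e ]≔ false) κ ≡ coneAt {κ} (monochromatic? κ) f (t [ e ]≔ false)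
    valid-below e te = trans (cong (λ b → 𝟙 b * coneAt {κ} (monochromatic? κ) f (t [ e ]≔ false))
                                   (isValid-mono κ (Insertion.s⊆t t e te) vt))
                             (*-identityˡ (coneAt {κ} (monochromatic? κ) f (t [ e ]≔ false)))

    no-edges : ¬ (∃ λ e → Monochromatic κ e ≡ true) → NoEdges t
    no-edges none e with true-or-false (lookup t e)
    ... | inj₁ te = ⊥-elim (none (e , isValid⇒monochromatic t κ vt e te))
    ... | inj₂ te = te

    by-choice : (d : Dec (∃ λ e → Monochromatic κ e ≡ true)) → D̂ (λ s _ → coneAt {κ} d f s) t κ ≡ f t κ
    by-choice (yes (e₀ , mono)) = D̂-cone f κ e₀ mono cocycle t vt
    by-choice (no none)         = trans (D̂-empty (λ s _ → coneAt {κ} (no none) f s) t κ (no-edges none))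
                                        (sym (f-empty t (no-edges none)))

  -- Cohomology

  isEmpty⇒NoEdges : ∀ t → isEmpty Γ t ≡ true → NoEdges t
  isEmpty⇒NoEdges t h e with true-or-false (lookup t e)
  ... | inj₁ te = ⊥-elim (true≢false (trans (sym h) (cong not (anyFin-true⁺ (lookup t) e te))))
  ... | inj₂ te = te

  NoEdges⇒isEmpty : ∀ t → NoEdges t → isEmpty Γ t ≡ true
  NoEdges⇒isEmpty t none = cong not (none-false (lookup t) none)
    where
    none-false : ∀ {k} (f : Fin k → Bool) → (∀ i → f i ≡ false) → anyFin Γ f ≡ false
    none-false {zero}  f h = refl
    none-false {suc k} f h rewrite h zero = none-false (f ∘ suc) (h ∘ suc)

  ∣∣≡0⇒NoEdges : ∀ t → ∣ t ∣ ≡ 0 → NoEdges t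
  ∣∣≡0⇒NoEdges t h e = ∣∣≡0⇒false t e h
    where
    ∣∣≡0⇒false : ∀ {n} (p : Subset n) i → ∣ p ∣ ≡ 0 → lookup p i ≡ false
    ∣∣≡0⇒false (false ∷ p) zero    h = refl
    ∣∣≡0⇒false (false ∷ p) (suc i) h = ∣∣≡0⇒false p i h

  NoEdges⇒≡⊥ : ∀ t → NoEdges t → t ≡ Subset.⊥
  NoEdges⇒≡⊥ t none = Subsetₚ.Empty-unique λ (e , e∈t) → true≢false (trans (sym (Vecₚ.[]=⇒lookup e∈t)) (none e))

  NoEdges-∣∣ : ∀ t → NoEdges t → ∣ t ∣ ≡ 0
  NoEdges-∣∣ t none = trans (cong ∣_∣ (NoEdges⇒≡⊥ t none)) (Subsetₚ.∣⊥∣≡0 nE)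

  cochain-supported : ∀ i c → IsCochain Γ i c → Supported c
  cochain-supported i c (_ , off-valid) s ℓ vℓ =
    off-valid s ℓ (λ V → true≢false (trans (sym (Valid⇒isValid s ℓ V)) vℓ))

  supported-¬Valid : ∀ c → Supported c → ∀ s ℓ → ¬ Valid Γ s ℓ → c s ℓ ≡ 0ℚ
  supported-¬Valid c supp s ℓ nv with true-or-false (isValid s ℓ)
  ... | inj₁ vℓ = ⊥-elim (nv (isValid⇒Valid s ℓ vℓ))
  ... | inj₂ vℓ = supp s ℓ vℓ

  ℱ-degree : ∀ i c → IsCochain Γ i c → ∀ t κ → ∣ t ∣ ≢ i → ℱ c t κ ≡ 0ℚ
  ℱ-degree i c (off-degree , _) t κ h = transform-zero W c t κ (λ ℓ → off-degree t ℓ h)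

  ℱ-closed : ∀ c → Supported c → _≗ᶜ_ Γ (D Γ c) (zeroᶜ Γ) → ∀ t κ → isValid t κ ≡ true → D̂ (ℱ c) t κ ≡ 0ℚ
  ℱ-closed c supp closed t κ vt = trans (sym (ℱ-D c supp t κ vt)) (transform-zero W (D Γ c) t κ (closed t))

  ℱ-closed-empty : ∀ c → Supported c → _≗ᶜ_ Γ (D Γ c) (zeroᶜ Γ) →
    ∀ t κ e₀ → Monochromatic κ e₀ ≡ true → NoEdges t → ℱ c t κ ≡ 0ℚ
  ℱ-closed-empty c supp closed t κ e₀ mono none =
    trans (sym (D̂-cone (ℱ c) κ e₀ mono (λ t′ → ℱ-closed c supp closed t′ κ) t (NoEdges-valid t κ none)))
          (D̂-empty (cone e₀ (ℱ c)) t κ none)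

  contraction-degree : ∀ j f → (∀ t κ → ∣ t ∣ ≢ suc j → f t κ ≡ 0ℚ) → ∀ s κ → ∣ s ∣ ≢ j → contraction f s κ ≡ 0ℚ
  contraction-degree j f off-degree s κ s≢j =
    trans (cong (𝟙 (isValid s κ) *_) (by-choice (monochromatic? κ))) (*-zeroʳ (𝟙 (isValid s κ)))
    where
    by-choice : (d : Dec (∃ λ e → Monochromatic κ e ≡ true)) → coneAt {κ} d f s ≡ 0ℚ
    by-choice (no _)          = refl
    by-choice (yes (e₀ , _)) with lookup s e₀ in se₀
    ... | true  = refl
    ... | false = trans (cong (σ s e₀ *_) (off-degree _ κ (λ eq → s≢j (ℕₚ.suc-injective
                    (trans (sym (∣∣-insert s e₀ se₀)) eq))))) (*-zeroʳ (σ s e₀))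

  H-vanishes-suc : ∀ j → HVanishes Γ (suc j)
  H-vanishes-suc j c c-cochain c-closed = b , (b-degree , supported-¬Valid b b-supp) , Db≗c
    where
    c-supp = cochain-supported (suc j) c c-cochain
    f = ℱ c
    g = contraction f
    b = ℱ⁻¹ g
    b-supp = transform-supported W½ g

    b-degree : ∀ s ℓ → ∣ s ∣ ≢ j → b s ℓ ≡ 0ℚ
    b-degree s ℓ s≢j = transform-zero W½ g s ℓ (λ κ → contraction-degree j f (ℱ-degree (suc j) c c-cochain) s κ s≢j)

    ℱDb≗ℱc : ∀ t κ → isValid t κ ≡ true → ℱ (D Γ b) t κ ≡ f t κ
    ℱDb≗ℱc t κ vt = begin
      ℱ (D Γ b) t κ  ≡⟨ ℱ-D b b-supp t κ vt ⟩
      D̂ (ℱ b) t κ    ≡⟨ D̂-cong (ℱ b) g t κ (λ e _ → ℱ-ℱ⁻¹ g (contraction-supported f) _ κ) ⟩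
      D̂ g t κ        ≡⟨ D̂-contraction f κ (λ t′ → ℱ-closed c c-supp c-closed t′ κ) at-empty t vt ⟩
      f t κ          ∎
      where
      open ≡-Reasoning
      at-empty : ∀ t → NoEdges t → f t κ ≡ 0ℚ
      at-empty t none = ℱ-degree (suc j) c c-cochain t κ (λ eq → ℕₚ.0≢1+n (trans (sym (NoEdges-∣∣ t none)) eq))

    Db≗c : _≗ᶜ_ Γ (D Γ b) c
    Db≗c = ℱ-injective (D Γ b) c (D-supported b b-supp) c-supp ℱDb≗ℱc

  colouring-of : Labelling Γ → Fin nV → Bool
  colouring-of κ v = eqL (lookup κ v) ex

  no-monochromatic⇒bipartition : ∀ κ → ¬ (∃ λ e → Monochromatic κ e ≡ true) → IsBipartition Γ (colouring-of κ)
  no-monochromatic⇒bipartition κ none e same = none (e ,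
    subst (λ x → eqL (lookup κ (src Γ e)) x ≡ true) (eqL-ex-injective _ _ same) (eqL-refl _))

  H⁰-vanishes : ¬ Bipartite Γ → HVanishes Γ 0
  H⁰-vanishes not-bipartite c c-cochain c-closed = ℱ-injective c (zeroᶜ Γ) c-supp (λ _ _ _ → refl) at
    where
    c-supp = cochain-supported 0 c c-cochain
    ℱc≡0 : ∀ t κ → ℱ c t κ ≡ 0ℚ
    ℱc≡0 t κ with ∣ t ∣ ℕ.≟ 0 | monochromatic? κ
    ... | no  t≢0 | _              = ℱ-degree 0 c c-cochain t κ t≢0
    ... | yes t≡0 | yes (e₀ , mono) = ℱ-closed-empty c c-supp c-closed t κ e₀ mono (∣∣≡0⇒NoEdges t t≡0)
    ... | yes t≡0 | no none        = ⊥-elim (not-bipartite (colouring-of κ , no-monochromatic⇒bipartition κ none))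
    at : ∀ t κ → isValid t κ ≡ true → ℱ c t κ ≡ ℱ (zeroᶜ Γ) t κ
    at t κ _ = trans (ℱc≡0 t κ) (sym (transform-zero W (zeroᶜ Γ) t κ (λ _ → refl)))

  labelling-of : (Fin nV → Bool) → Labelling Γ
  labelling-of col = tabulate (label ∘ col)

  ε : (Fin nV → Bool) → ℚ
  ε col = prodFin nV (λ v → if col v then - 1ℚ else 1ℚ)

  ε-sq : ∀ col → ε col * ε col ≡ 1ℚ
  ε-sq col = trans (sym (prodFin-* nV _ _)) (prodFin-one nV (λ v → sq (col v)))
    where
    sq : ∀ b → (if b then - 1ℚ else 1ℚ) * (if b then - 1ℚ else 1ℚ) ≡ 1ℚ
    sq true  = refl
    sq false = refl

  ∏ᶜ-NoEdges : ∀ t F → NoEdges t → ∏ᶜ t F ≡ prodFin nV F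
  ∏ᶜ-NoEdges t F none = prodFin-cong nV (λ v → cong (λ b → if b then F v else 1ℚ) (NoEdges-isRep t v none))

  a-χ : ∀ b k → sumLabel (λ y → (if b then a₁ Γ y else a₀ Γ y) * χ y k) ≡ (if b then - 1ℚ else 1ℚ) * 𝟙 (eqL (label b) k)
  a-χ true  one = refl
  a-χ true  ex  = refl
  a-χ false one = refl
  a-χ false ex  = refl

  -- S₀ is, up to the sign ε, the basis vector dual to the colouring of its bipartition.
  ℱS₀-empty : ∀ col t κ → NoEdges t → ℱ (S₀ Γ col) t κ ≡ ε col * 𝟙 (eqVecL (labelling-of col) κ)
  ℱS₀-empty col t κ none rewrite NoEdges-valid t κ none | NoEdges⇒isEmpty t none = begin
    1ℚ * sumList labellings (λ ℓ → prodFin nV (a ℓ) * W t ℓ κ)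
      ≡⟨ *-identityˡ _ ⟩
    sumList labellings (λ ℓ → prodFin nV (a ℓ) * W t ℓ κ)
      ≡⟨ sumList-cong labellings (λ ℓ → trans (cong (_* W t ℓ κ) (sym (∏ᶜ-NoEdges t (a ℓ) none)))
           (trans (∏ᶜ-* t (a ℓ) _) (sym (trans (cong (λ b → 𝟙 b * P ℓ) (NoEdges-valid t ℓ none)) (*-identityˡ (P ℓ)))))) ⟩
    sumList labellings (λ ℓ → 𝟙 (isValid t ℓ) * ∏ᶜ t (λ v → a ℓ v * χ (lookup ℓ v) (lookup κ v)))
      ≡⟨ sumValid-∏ᶜ t (λ v y → (if col v then a₁ Γ y else a₀ Γ y) * χ y (lookup κ v)) ⟩
    ∏ᶜ t (λ v → sumLabel (λ y → (if col v then a₁ Γ y else a₀ Γ y) * χ y (lookup κ v)))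
      ≡⟨ trans (∏ᶜ-NoEdges t _ none) (prodFin-cong nV (λ v → a-χ (col v) (lookup κ v))) ⟩
    prodFin nV (λ v → (if col v then - 1ℚ else 1ℚ) * 𝟙 (eqL (label (col v)) (lookup κ v)))
      ≡⟨ prodFin-* nV _ _ ⟩
    ε col * prodFin nV (λ v → 𝟙 (eqL (label (col v)) (lookup κ v)))
      ≡⟨ cong (ε col *_) (trans (prodFin-cong nV (λ v → cong (λ x → 𝟙 (eqL x (lookup κ v)))
                                  (sym (Vecₚ.lookup∘tabulate (label ∘ col) v))))
                                (prodFin-𝟙-eqL (labelling-of col) κ)) ⟩
    ε col * 𝟙 (eqVecL (labelling-of col) κ) ∎
    where
    open ≡-Reasoning
    a : Labelling Γ → Fin nV → ℚ
    a ℓ v = if col v then a₁ Γ (lookup ℓ v) else a₀ Γ (lookup ℓ v)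
    P : Labelling Γ → ℚ
    P ℓ = ∏ᶜ t (λ v → a ℓ v * χ (lookup ℓ v) (lookup κ v))

  ℱS₀-nonempty : ∀ col t κ → isEmpty Γ t ≡ false → ℱ (S₀ Γ col) t κ ≡ 0ℚ
  ℱS₀-nonempty col t κ ne = transform-zero W (S₀ Γ col) t κ (λ ℓ → at ℓ)
    where
    at : ∀ ℓ → S₀ Γ col t ℓ ≡ 0ℚ
    at ℓ rewrite ne = refl

  S₀-cochain : ∀ col → IsCochain Γ 0 (S₀ Γ col)
  S₀-cochain col = off-degree , off-valid
    where
    off-degree : ∀ s ℓ → ∣ s ∣ ≢ 0 → S₀ Γ col s ℓ ≡ 0ℚ
    off-degree s ℓ s≢0 with isEmpty Γ s in es
    ... | true  = ⊥-elim (s≢0 (NoEdges-∣∣ s (isEmpty⇒NoEdges s es)))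
    ... | false = refl
    off-valid : ∀ s ℓ → ¬ Valid Γ s ℓ → S₀ Γ col s ℓ ≡ 0ℚ
    off-valid s ℓ nv with isEmpty Γ s in es
    ... | true  = ⊥-elim (nv (isValid⇒Valid s ℓ (NoEdges-valid s ℓ (isEmpty⇒NoEdges s es))))
    ... | false = refl

  labelling-of-≢ : ∀ col → IsBipartition Γ col → ∀ κ e → Monochromatic κ e ≡ true →
    eqVecL (labelling-of col) κ ≡ false
  labelling-of-≢ col bp κ e mono with eqVecL (labelling-of col) κ in eq
  ... | false = refl
  ... | true  = ⊥-elim (true≢false (trans (sym mono) (subst (λ λ′ → Monochromatic λ′ e ≡ false)
      (eqVecL⇒≡ (labelling-of col) κ eq) proper)))
    where
    proper : Monochromatic (labelling-of col) e ≡ false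
    proper rewrite Vecₚ.lookup∘tabulate (label ∘ col) (src Γ e) | Vecₚ.lookup∘tabulate (label ∘ col) (tgt Γ e) =
      eqL-label (col (src Γ e)) (col (tgt Γ e)) (bp e)

  ℱS₀-monochromatic : ∀ col → IsBipartition Γ col → ∀ t κ e → Monochromatic κ e ≡ true → ℱ (S₀ Γ col) t κ ≡ 0ℚ
  ℱS₀-monochromatic col bp t κ e mono with true-or-false (isEmpty Γ t)
  ... | inj₂ ne = ℱS₀-nonempty col t κ ne
  ... | inj₁ et = trans (ℱS₀-empty col t κ (isEmpty⇒NoEdges t et))
      (trans (cong (λ b → ε col * 𝟙 b) (labelling-of-≢ col bp κ e mono)) (*-zeroʳ (ε col)))

  S₀-closed : ∀ col → IsBipartition Γ col → _≗ᶜ_ Γ (D Γ (S₀ Γ col)) (zeroᶜ Γ)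
  S₀-closed col bp = ℱ-injective (D Γ (S₀ Γ col)) (zeroᶜ Γ) (D-supported (S₀ Γ col) S₀-supp) (λ _ _ _ → refl) at
    where
    S₀-supp = cochain-supported 0 (S₀ Γ col) (S₀-cochain col)
    at : ∀ t κ → isValid t κ ≡ true → ℱ (D Γ (S₀ Γ col)) t κ ≡ ℱ (zeroᶜ Γ) t κ
    at t κ vt = begin
      ℱ (D Γ (S₀ Γ col)) t κ  ≡⟨ ℱ-D (S₀ Γ col) S₀-supp t κ vt ⟩
      D̂ (ℱ (S₀ Γ col)) t κ    ≡⟨ D̂-zero (ℱ (S₀ Γ col)) t κ (λ e te →
                                  ℱS₀-monochromatic col bp _ κ e (isValid⇒monochromatic t κ vt e te)) ⟩
      0ℚ                      ≡⟨ transform-zero W (zeroᶜ Γ) t κ (λ _ → refl) ⟨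
      ℱ (zeroᶜ Γ) t κ         ∎
      where open ≡-Reasoning

  S₁≡S₀-not : ∀ col s ℓ → S₁ Γ col s ℓ ≡ S₀ Γ (not ∘ col) s ℓ
  S₁≡S₀-not col s ℓ with isEmpty Γ s
  ... | false = refl
  ... | true  = prodFin-cong nV (λ v → swap (col v) (lookup ℓ v))
    where
    swap : ∀ b x → (if b then a₀ Γ x else a₁ Γ x) ≡ (if not b then a₁ Γ x else a₀ Γ x)
    swap true  x = refl
    swap false x = refl

  not-bipartition : ∀ col → IsBipartition Γ col → IsBipartition Γ (not ∘ col)
  not-bipartition col bp e eq = bp e (Boolₚ.not-injective eq)

  proper-colourings : Connected Γ → ∀ col → IsBipartition Γ col → ∀ κ → ¬ (∃ λ e → Monochromatic κ e ≡ true) →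
    κ ≡ labelling-of col ⊎ κ ≡ labelling-of (not ∘ col)
  proper-colourings (nV>0 , connected) col bp κ none = by-agreement (true-or-false (agree v₀))
    where
    v₀ = Data.Fin.fromℕ< nV>0
    agree : Fin nV → Bool
    agree v = eqL (lookup κ v) (label (col v))

    bichromatic : ∀ e → Monochromatic κ e ≡ false
    bichromatic e with true-or-false (Monochromatic κ e)
    ... | inj₁ mono = ⊥-elim (none (e , mono))
    ... | inj₂ bi   = bi

    agree-everywhere : ∀ w → agree w ≡ agree v₀
    agree-everywhere w = sameComp-invariant ⊤ agree (λ e _ →
      eqL-both-differ _ _ _ _ (bichromatic e) (eqL-label (col (src Γ e)) (col (tgt Γ e)) (bp e))) v₀ w (connected v₀ w)

    by-agreement : agree v₀ ≡ true ⊎ agree v₀ ≡ false → κ ≡ labelling-of col ⊎ κ ≡ labelling-of (not ∘ col)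
    by-agreement (inj₁ yes₀) = inj₁ (trans (sym (Vecₚ.tabulate∘lookup κ)) (Vecₚ.tabulate-cong λ w →
      eqL⇒≡ _ _ (trans (agree-everywhere w) yes₀)))
    by-agreement (inj₂ no₀)  = inj₂ (trans (sym (Vecₚ.tabulate∘lookup κ)) (Vecₚ.tabulate-cong λ w →
      eqL-label-not _ (col w) (trans (agree-everywhere w) no₀)))

  D-cong : ∀ c c′ → _≗ᶜ_ Γ c c′ → _≗ᶜ_ Γ (D Γ c) (D Γ c′)
  D-cong c c′ c≗c′ t μ = sumFin-cong nE λ e → cong (λ F → if lookup t e then F else 0ℚ)
    (sumList-cong labellings λ ℓ → cong (λ x → if eqVecL (Tlab Γ (t [ e ]≔ false) e ℓ) μ then σ (t [ e ]≔ false) e * x else 0ℚ)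
      (c≗c′ (t [ e ]≔ false) ℓ))

  lin-cochain : ∀ i p X q Y → IsCochain Γ i X → IsCochain Γ i Y → IsCochain Γ i (lin Γ p X q Y)
  lin-cochain i p X q Y (X-deg , X-valid) (Y-deg , Y-valid) =
    (λ s ℓ h → both s ℓ (X-deg s ℓ h) (Y-deg s ℓ h)) , (λ s ℓ h → both s ℓ (X-valid s ℓ h) (Y-valid s ℓ h))
    where
    both : ∀ s ℓ → X s ℓ ≡ 0ℚ → Y s ℓ ≡ 0ℚ → lin Γ p X q Y s ℓ ≡ 0ℚ
    both s ℓ X≡0 Y≡0 rewrite X≡0 | Y≡0 = solve 2 (λ p q → p :* con 0ℚ :+ q :* con 0ℚ := con 0ℚ) refl p q

  eqVecL-differ : ∀ {n} (X Y : Vec Label n) v → eqL (lookup X v) (lookup Y v) ≡ false → eqVecL X Y ≡ false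
  eqVecL-differ X Y v differ with eqVecL X Y in eq
  ... | false = refl
  ... | true rewrite eqVecL⇒≡ X Y eq = sym (trans (sym differ) (eqL-refl (lookup Y v)))

  module H⁰-Basis (conn : Connected Γ) (col : Fin nV → Bool) (bp : IsBipartition Γ col) where

    ncol : Fin nV → Bool
    ncol = not ∘ col

    L₀ L₁ : Labelling Γ
    L₀ = labelling-of col
    L₁ = labelling-of ncol

    L₀≢L₁ : eqVecL L₀ L₁ ≡ false
    L₀≢L₁ = eqVecL-differ L₀ L₁ v₀ (subst₂ (λ x y → eqL x y ≡ false)
      (sym (Vecₚ.lookup∘tabulate (label ∘ col) v₀)) (sym (Vecₚ.lookup∘tabulate (label ∘ ncol) v₀))
      (eqL-label (col v₀) (ncol v₀) (Boolₚ.not-¬ refl)))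
      where v₀ = Data.Fin.fromℕ< (proj₁ conn)

    L₁≢L₀ : eqVecL L₁ L₀ ≡ false
    L₁≢L₀ = trans (eqVecL-comm L₁ L₀) L₀≢L₁

    S₁-cochain : IsCochain Γ 0 (S₁ Γ col)
    S₁-cochain = (λ s ℓ h → trans (S₁≡S₀-not col s ℓ) (proj₁ (S₀-cochain ncol) s ℓ h))
               , (λ s ℓ h → trans (S₁≡S₀-not col s ℓ) (proj₂ (S₀-cochain ncol) s ℓ h))

    S₁-closed : _≗ᶜ_ Γ (D Γ (S₁ Γ col)) (zeroᶜ Γ)
    S₁-closed t μ = trans (D-cong (S₁ Γ col) (S₀ Γ ncol) (S₁≡S₀-not col) t μ)
                          (S₀-closed ncol (not-bipartition col bp) t μ)

    ℱ-basis : ∀ p q κ → ℱ (lin Γ p (S₀ Γ col) q (S₁ Γ col)) Subset.⊥ κ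
                      ≡ p * (ε col * 𝟙 (eqVecL L₀ κ)) + q * (ε ncol * 𝟙 (eqVecL L₁ κ))
    ℱ-basis p q κ = trans (transform-lin W p (S₀ Γ col) q (S₁ Γ col) Subset.⊥ κ) (cong₂ (λ x y → p * x + q * y)
      (ℱS₀-empty col Subset.⊥ κ ⊥-NoEdges)
      (trans (transform-cong W {S₁ Γ col} {S₀ Γ ncol} Subset.⊥ κ (S₁≡S₀-not col Subset.⊥))
             (ℱS₀-empty ncol Subset.⊥ κ ⊥-NoEdges)))

    ℱ-basis-L₀ : ∀ p q → ℱ (lin Γ p (S₀ Γ col) q (S₁ Γ col)) Subset.⊥ L₀ ≡ p * ε col
    ℱ-basis-L₀ p q = trans (ℱ-basis p q L₀) diagonal
      where
      diagonal : p * (ε col * 𝟙 (eqVecL L₀ L₀)) + q * (ε ncol * 𝟙 (eqVecL L₁ L₀)) ≡ p * ε col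
      diagonal rewrite eqVecL-refl L₀ | L₁≢L₀ =
        solve 4 (λ p q e e′ → p :* (e :* con 1ℚ) :+ q :* (e′ :* con 0ℚ) := p :* e) refl p q (ε col) (ε ncol)

    ℱ-basis-L₁ : ∀ p q → ℱ (lin Γ p (S₀ Γ col) q (S₁ Γ col)) Subset.⊥ L₁ ≡ q * ε ncol
    ℱ-basis-L₁ p q = trans (ℱ-basis p q L₁) diagonal
      where
      diagonal : p * (ε col * 𝟙 (eqVecL L₀ L₁)) + q * (ε ncol * 𝟙 (eqVecL L₁ L₁)) ≡ q * ε ncol
      diagonal rewrite eqVecL-refl L₁ | L₀≢L₁ =
        solve 4 (λ p q e e′ → p :* (e :* con 0ℚ) :+ q :* (e′ :* con 1ℚ) := q :* e′) refl p q (ε col) (ε ncol)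

    ℱ-basis-monochromatic : ∀ p q κ e → Monochromatic κ e ≡ true → ℱ (lin Γ p (S₀ Γ col) q (S₁ Γ col)) Subset.⊥ κ ≡ 0ℚ
    ℱ-basis-monochromatic p q κ e mono = trans (ℱ-basis p q κ) vanish
      where
      vanish : p * (ε col * 𝟙 (eqVecL L₀ κ)) + q * (ε ncol * 𝟙 (eqVecL L₁ κ)) ≡ 0ℚ
      vanish rewrite labelling-of-≢ col bp κ e mono | labelling-of-≢ ncol (not-bipartition col bp) κ e mono =
        solve 4 (λ p q e e′ → p :* (e :* con 0ℚ) :+ q :* (e′ :* con 0ℚ) := con 0ℚ) refl p q (ε col) (ε ncol)

    independent : ∀ p q → _≗ᶜ_ Γ (lin Γ p (S₀ Γ col) q (S₁ Γ col)) (zeroᶜ Γ) → p ≡ 0ℚ × q ≡ 0ℚ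
    independent p q L≗0 = square-one-cancel p (ε col) (ε-sq col) (trans (sym (ℱ-basis-L₀ p q)) (ℱL≡0 L₀))
                        , square-one-cancel q (ε ncol) (ε-sq ncol) (trans (sym (ℱ-basis-L₁ p q)) (ℱL≡0 L₁))
      where
      ℱL≡0 : ∀ κ → ℱ (lin Γ p (S₀ Γ col) q (S₁ Γ col)) Subset.⊥ κ ≡ 0ℚ
      ℱL≡0 κ = transform-zero W (lin Γ p (S₀ Γ col) q (S₁ Γ col)) Subset.⊥ κ (L≗0 Subset.⊥)

    spans : ∀ c → IsCochain Γ 0 c → _≗ᶜ_ Γ (D Γ c) (zeroᶜ Γ) →
      ∃ λ p → ∃ λ q → _≗ᶜ_ Γ c (lin Γ p (S₀ Γ col) q (S₁ Γ col))
    spans c c-cochain c-closed = p , q , ℱ-injective c L c-supp L-supp at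
      where
      c-supp = cochain-supported 0 c c-cochain
      p = ε col * ℱ c Subset.⊥ L₀
      q = ε ncol * ℱ c Subset.⊥ L₁
      L = lin Γ p (S₀ Γ col) q (S₁ Γ col)
      L-cochain = lin-cochain 0 p (S₀ Γ col) q (S₁ Γ col) (S₀-cochain col) S₁-cochain
      L-supp = cochain-supported 0 L L-cochain

      at-⊥ : ∀ κ → ℱ c Subset.⊥ κ ≡ ℱ L Subset.⊥ κ
      at-⊥ κ with monochromatic? κ
      ... | yes (e₀ , mono) = trans (ℱ-closed-empty c c-supp c-closed Subset.⊥ κ e₀ mono ⊥-NoEdges)
                                    (sym (ℱ-basis-monochromatic p q κ e₀ mono))
      ... | no none with proper-colourings conn col bp κ none
      ...   | inj₁ refl = trans (square-one-sandwich (ε col) (ℱ c Subset.⊥ L₀) (ε-sq col)) (sym (ℱ-basis-L₀ p q))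
      ...   | inj₂ refl = trans (square-one-sandwich (ε ncol) (ℱ c Subset.⊥ L₁) (ε-sq ncol)) (sym (ℱ-basis-L₁ p q))

      at : ∀ t κ → isValid t κ ≡ true → ℱ c t κ ≡ ℱ L t κ
      at t κ _ with ∣ t ∣ ℕ.≟ 0
      ... | no t≢0  = trans (ℱ-degree 0 c c-cochain t κ t≢0) (sym (ℱ-degree 0 L L-cochain t κ t≢0))
      ... | yes t≡0 rewrite NoEdges⇒≡⊥ t (∣∣≡0⇒NoEdges t t≡0) = at-⊥ κ

    basis : IsH0Basis Γ (S₀ Γ col) (S₁ Γ col)
    basis = S₀-cochain col , S₁-cochain , S₀-closed col bp , S₁-closed , independent , spans

mainTheorem4 : (Γ : Graph) → Connected Γ →
    ((¬ Bipartite Γ) → ∀ i → HVanishes Γ i)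
    × ((col : Fin (Graph.nV Γ) → Bool) → IsBipartition Γ col →
        (∀ i → 0 < i → HVanishes Γ i) × IsH0Basis Γ (S₀ Γ col) (S₁ Γ col))
mainTheorem4 Γ conn = non-bipartite , bipartite
  where
  positive : ∀ i → 0 < i → HVanishes Γ i
  positive (suc j) _ = H-vanishes-suc Γ j

  non-bipartite : ¬ Bipartite Γ → ∀ i → HVanishes Γ i
  non-bipartite not-bipartite zero    = H⁰-vanishes Γ not-bipartite
  non-bipartite not-bipartite (suc j) = positive (suc j) (s≤s z≤n)

  bipartite : (col : Fin (Graph.nV Γ) → Bool) → IsBipartition Γ col →
    (∀ i → 0 < i → HVanishes Γ i) × IsH0Basis Γ (S₀ Γ col) (S₁ Γ col)
  bipartite col bipartition = positive , H⁰-Basis.basis Γ conn col bipartition
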